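{- Let $n\ge1$ and $k\ge2$ be integers and put $s=3k+2n$, $K_1=1-\frac{1}{\sqrt2}-\frac{3k}{2}+\frac{3k}{\sqrt2}$, $K_2=1-\frac{3k}{2}+\frac{\sqrt{1-12k+18k^2}}{2}$, $K_3=1-\frac{3k}{2}+\frac{\sqrt{ -1-6k+9k^2}}{\sqrt2}$, $K_4=1-\frac{3k}{2}+\frac{\sqrt{ -7-12k+18k^2}}{2}$. Then $Mcut(R_{n,k})$ equals: (a) $\frac23$ if $n=1,k=2$; (b) $\frac{4}{s-2}$ if $k\ge4$, $3\mid n$, $2\mid k$ and $n<K_1$; (c) $\frac{4(s-2)}{(s-5)(s+1)}$ if $k\ge4$, $3\mid n$, $2\nmid k$ and $n<K_4$; (d) $\frac{4(s-2)}{(s-4)s}$ if $k\ge4$, $3\nmid n$, $2\mid k$ and $n<K_3$; (e) $\frac{4(s-2)}{(s-3)(s-1)}$ if ($k\ge4$, $3\nmid n$, $2\nmid k$ and $n<K_2$) or $(n,k)=(1,3)$ or $(n,k)=(2,3)$; (f) $\frac{6k+4n-4}{(2n-1)(6k+2n-3)}$ if either $k\ge4$ and [($3\mid n,2\mid k,K_1\le n$) or ($3\mid n,2\nmid k,K_4\le n$) or ($3\nmid n,2\mid k,K_3\le n$) or ($3\nmid n,2\nmid k,K_2\le n$)], or ($k=2$ and $n\ge2$), or ($k=3$ and $n\ge3$).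
   Context: $R_{n,k}$ ($n\ge1,k\ge2$) is the unweighted graph on vertices $x_1,\dots,x_{n+k},y_1,\dots,y_{n+k}$ with edges $x_ix_{i+1}$ and $y_iy_{i+1}$ for $1\le i\le n+k-1$, and $x_iy_i$ for $n+1\le i\le n+k$. For a graph $G=(V,E)$ with vertex degrees $d_v$: $vol(S)=\sum_{v\in S}d_v$; $cut(S,T)$ is the number of edges between disjoint sets $S,T$; $Ncut(S,T)=cut(S,T)\left(\frac1{vol(S)}+\frac1{vol(T)}\right)$; $Mcut(G)=\min\{Ncut(S,V\setminus S):\emptyset\ne S\subsetneq V\}$. -}

module Defs where

open import Data.Bool using (Bool; true; false; not; _∧_; _∨_; _xor_; if_then_else_)
open import Data.Nat as ℕ using (ℕ; zero; suc; _+_; _*_; _∸_; _≡ᵇ_; _≤ᵇ_)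
open import Data.Fin using (Fin; toℕ)
open import Data.List using (List; map; _++_; allFin)
open import Data.Nat.ListAction using (sum)
open import Data.Product using (_×_; _,_; ∃)
open import Data.Integer using (+_)
open import Data.Rational as ℚ using (ℚ; 0ℚ)
open import Relation.Binary.PropositionalEquality using (_≡_)

-- Vertices of R_{n,k}: (false , i) is x_{i+1}, (true , i) is y_{i+1}, i : Fin (n + k).
Vertex : ℕ → ℕ → Set
Vertex n k = Bool × Fin (n + k)

vertices : (n k : ℕ) → List (Vertex n k)
vertices n k = map (false ,_) (allFin (n + k)) ++ map (true ,_) (allFin (n + k))

-- Adjacency in R_{n,k} (0-based indices):
--   x_i x_{i+1}, y_i y_{i+1}   (consecutive indices, same side)
--   x_i y_i for n+1 ≤ i ≤ n+k  i.e. 0-based index i with n ≤ i.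
adj : (n k : ℕ) → Vertex n k → Vertex n k → Bool
adj n k (b , i) (c , j) =
  if not (b xor c)
  then ((suc (toℕ i) ≡ᵇ toℕ j) ∨ (suc (toℕ j) ≡ᵇ toℕ i))
  else ((toℕ i ≡ᵇ toℕ j) ∧ (n ≤ᵇ toℕ i))

count : {A : Set} → (A → Bool) → List A → ℕ
count p xs = sum (map (λ a → if p a then 1 else 0) xs)

degree : (n k : ℕ) → Vertex n k → ℕ
degree n k v = count (adj n k v) (vertices n k)

VSet : ℕ → ℕ → Set
VSet n k = Vertex n k → Bool

complement : (n k : ℕ) → VSet n k → VSet n k
complement n k S v = not (S v)

vol : (n k : ℕ) → VSet n k → ℕ
vol n k S = sum (map (λ v → if S v then degree n k v else 0) (vertices n k))

cutC : (n k : ℕ) → VSet n k → ℕ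
cutC n k S = sum (map (λ u → count (λ v → S u ∧ (not (S v) ∧ adj n k u v)) (vertices n k)) (vertices n k))

-- 1/m as a rational; the value at 0 is never used (R_{n,k} is connected
-- without isolated vertices, so nonempty sets have positive volume).
recip : ℕ → ℚ
recip zero = 0ℚ
recip (suc m) = (+ 1) ℚ./ suc m

-- a/b as a rational (b > 0 in every use below).
frac : ℕ → ℕ → ℚ
frac a zero = 0ℚ
frac a (suc b) = (+ a) ℚ./ suc b

Ncut : (n k : ℕ) → VSet n k → ℚ
Ncut n k S = ((+ cutC n k S) ℚ./ 1) ℚ.* (recip (vol n k S) ℚ.+ recip (vol n k (complement n k S)))

NonemptyProper : (n k : ℕ) → VSet n k → Set
NonemptyProper n k S = (∃ λ v → S v ≡ true) × (∃ λ v → S v ≡ false)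

IsMcut : (n k : ℕ) → ℚ → Set
IsMcut n k r =
  (∃ λ S → NonemptyProper n k S × Ncut n k S ≡ r) ×
  ((S : VSet n k) → NonemptyProper n k S → r ℚ.≤ Ncut n k S)

-- Threshold comparisons with K_1..K_4, squared out (valid for n ≥ 1, k ≥ 4,
-- where both sides are positive). Let m = 2n + 3k - 2.
--  n < K1  ⇔  m² < 2(3k-1)²         ⇔ m² + 12k < 18k² + 2
--  n < K2  ⇔  m² < 18k² - 12k + 1   ⇔ m² + 12k < 18k² + 1
--  n < K3  ⇔  m² < 2(9k² - 6k - 1)  ⇔ m² + 12k + 2 < 18k²
--  n < K4  ⇔  m² < 18k² - 12k - 7   ⇔ m² + 12k + 7 < 18k²
mK : ℕ → ℕ → ℕ
mK n k = (2 * n + 3 * k) ∸ 2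

LtK1 LtK2 LtK3 LtK4 GeK1 GeK2 GeK3 GeK4 : ℕ → ℕ → Set
LtK1 n k = mK n k * mK n k + 12 * k ℕ.< 18 * (k * k) + 2
LtK2 n k = mK n k * mK n k + 12 * k ℕ.< 18 * (k * k) + 1
LtK3 n k = mK n k * mK n k + 12 * k + 2 ℕ.< 18 * (k * k)
LtK4 n k = mK n k * mK n k + 12 * k + 7 ℕ.< 18 * (k * k)
GeK1 n k = 18 * (k * k) + 2 ℕ.≤ mK n k * mK n k + 12 * k
GeK2 n k = 18 * (k * k) + 1 ℕ.≤ mK n k * mK n k + 12 * k
GeK3 n k = 18 * (k * k) ℕ.≤ mK n k * mK n k + 12 * k + 2
GeK4 n k = 18 * (k * k) ℕ.≤ mK n k * mK n k + 12 * k + 7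

module Submission where

-- Index both rails by positions 0 … L, L = n + k - 1; the rungs sit at positions ≥ n,
-- positions < n form the two pendant paths.  A vertex set S is encoded by two Boolean
-- sequences A (rail x) and B (rail y).  Then vol S = V A + V B for a per-position
-- degree weight, and cut S = (switches of A) + (switches of B) + (rung mismatches).

open import Defs
open import Data.Nat using (ℕ; suc; _+_; _*_; _∸_; _≤_; z≤n; s≤s)
open import Data.Nat.Divisibility using (_∣_)
open import Data.Product using (_×_; _,_)
open import Data.Sum using (_⊎_)
open import Relation.Nullary using (¬_)
open import Relation.Binary.PropositionalEquality using (_≡_)

module FiniteSums where

  open import Data.Nat
  open import Data.Nat.Properties
  open import Data.Bool using (Bool; if_then_else_)
  open import Relation.Binary.PropositionalEquality
  open import Data.Nat.Tactic.RingSolver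

  bit : Bool → ℕ
  bit b = if b then 1 else 0

  sumTo : ℕ → (ℕ → ℕ) → ℕ
  sumTo zero f = 0
  sumTo (suc L) f = f 0 + sumTo L (λ i → f (suc i))

  sumTo-cong : ∀ L {f g : ℕ → ℕ} → (∀ i → i < L → f i ≡ g i) → sumTo L f ≡ sumTo L g
  sumTo-cong zero h = refl
  sumTo-cong (suc L) h = cong₂ _+_ (h 0 z<s) (sumTo-cong L (λ i p → h (suc i) (s<s p)))

  sumTo-mono : ∀ L {f g : ℕ → ℕ} → (∀ i → i < L → f i ≤ g i) → sumTo L f ≤ sumTo L g
  sumTo-mono zero h = z≤n
  sumTo-mono (suc L) h = +-mono-≤ (h 0 z<s) (sumTo-mono L (λ i p → h (suc i) (s<s p)))

  sumTo-snoc : ∀ L f → sumTo (suc L) f ≡ sumTo L f + f L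
  sumTo-snoc zero f = +-comm (f 0) 0
  sumTo-snoc (suc L) f = trans (cong (f 0 +_) (sumTo-snoc L (λ i → f (suc i)))) (sym (+-assoc (f 0) _ _))

  term≤sumTo : ∀ L f i → i < L → f i ≤ sumTo L f
  term≤sumTo (suc L) f zero _ = m≤m+n _ _
  term≤sumTo (suc L) f (suc i) (s<s p) = ≤-trans (term≤sumTo L _ i p) (m≤n+m _ _)

  twoTerms≤sumTo : ∀ L f i j → i < j → j < L → f i + f j ≤ sumTo L f
  twoTerms≤sumTo (suc L) f zero (suc j) _ (s<s p) = +-monoʳ-≤ (f 0) (term≤sumTo L _ j p)
  twoTerms≤sumTo (suc L) f (suc i) (suc j) (s<s q) (s<s p) = ≤-trans (twoTerms≤sumTo L _ i j q p) (m≤n+m _ _)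

  sumTo-zeros : ∀ L → sumTo L (λ _ → 0) ≡ 0
  sumTo-zeros zero = refl
  sumTo-zeros (suc L) = sumTo-zeros L

  sumTo-vanish : ∀ L f → (∀ i → i < L → f i ≡ 0) → sumTo L f ≡ 0
  sumTo-vanish L f h = trans (sumTo-cong L h) (sumTo-zeros L)

  sumTo-+ : ∀ L f g → sumTo L (λ i → f i + g i) ≡ sumTo L f + sumTo L g
  sumTo-+ zero f g = refl
  sumTo-+ (suc L) f g = trans (cong (f 0 + g 0 +_) (sumTo-+ L _ _)) (interchange (f 0) (g 0) _ _)
    where
    interchange : ∀ a b c d → a + b + (c + d) ≡ a + c + (b + d)
    interchange = solve-∀

  sumTo-splitAt : ∀ L j f g → j ≤ L → sumTo L (λ p → if p <ᵇ j then f p else g p) + sumTo j g ≡ sumTo j f + sumTo L g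
  sumTo-splitAt L zero f g _ = +-comm (sumTo L g) 0
  sumTo-splitAt (suc L) (suc j) f g (s≤s q) =
    trans (interchange (f 0) (g 0) _ _)
      (trans (cong (f 0 + g 0 +_) (sumTo-splitAt L j (λ p → f (suc p)) (λ p → g (suc p)) q))
        (interchange' (f 0) (g 0) _ _))
    where
    interchange : ∀ a b c d → a + c + (b + d) ≡ a + b + (c + d)
    interchange = solve-∀
    interchange' : ∀ a b c d → a + b + (c + d) ≡ a + c + (b + d)
    interchange' = solve-∀

  sumTo-monoˡ : ∀ j l f → j ≤ l → sumTo j f ≤ sumTo l f
  sumTo-monoˡ zero l f _ = z≤n
  sumTo-monoˡ (suc j) (suc l) f (s≤s q) = +-monoʳ-≤ (f 0) (sumTo-monoˡ j l _ q)

  <ᵇ-suc : ∀ n p → (n <ᵇ suc p) ≡ (n ≤ᵇ p)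
  <ᵇ-suc zero p = refl
  <ᵇ-suc (suc n) p = refl

  sumTo-indicator≥ : ∀ n k → sumTo (n + k) (λ p → if n ≤ᵇ p then 1 else 0) ≡ k
  sumTo-indicator≥ zero k = ones k
    where
    ones : ∀ k → sumTo k (λ p → 1) ≡ k
    ones zero = refl
    ones (suc k) = cong suc (ones k)
  sumTo-indicator≥ (suc n) k =
    trans (sumTo-cong (n + k) (λ p _ → cong (λ b → if b then 1 else 0) (<ᵇ-suc n p))) (sumTo-indicator≥ n k)

module VertexSums where

  open import Defs
  open FiniteSums
  open import Data.Nat
  open import Data.Nat.Properties
  open import Data.Bool using (Bool; true; false; _∧_; _∨_; if_then_else_)
  open import Data.Bool.Properties using (∧-identityʳ; ∧-zeroʳ)
  open import Data.Fin using (Fin; toℕ)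
  open import Data.Fin.Properties using (toℕ<n)
  open import Data.List using (List; map; _++_; tabulate; allFin)
  open import Data.List.Properties using (map-++)
  open import Data.Nat.ListAction using (sum)
  open import Data.Nat.ListAction.Properties using (sum-++)
  open import Data.Product using (_,_)
  open import Relation.Binary.PropositionalEquality
  open import Data.Empty
  open import Data.Unit using (tt)
  import Data.Bool
  open import Data.Nat.Tactic.RingSolver

  atIndex : {X : Set} → X → (N : ℕ) → (Fin N → X) → ℕ → X
  atIndex d zero f i = d
  atIndex d (suc N) f zero = f Fin.zero
  atIndex d (suc N) f (suc i) = atIndex d N (λ j → f (Fin.suc j)) i

  sum-tabulate : ∀ N {X Y : Set} (t : Fin N → X) (g : X → Y) (h : Y → ℕ) →
    sum (map h (map g (tabulate t))) ≡ sumTo N (atIndex 0 N (λ j → h (g (t j))))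
  sum-tabulate zero t g h = refl
  sum-tabulate (suc N) t g h = cong (h (g (t Fin.zero)) +_) (sum-tabulate N (λ j → t (Fin.suc j)) g h)

  atIndex-comp : ∀ N {X Y : Set} (dx : X) (dy : Y) (g : Fin N → X) (F : X → ℕ → Y) i → i < N →
    atIndex dy N (λ j → F (g j) (toℕ j)) i ≡ F (atIndex dx N g i) i
  atIndex-comp (suc N) dx dy g F zero _ = refl
  atIndex-comp (suc N) dx dy g F (suc i) (s<s p) = atIndex-comp N dx dy (λ j → g (Fin.suc j)) (λ x q → F x (suc q)) i p

  atIndex-toℕ : ∀ N {X : Set} (d : X) (g : Fin N → X) (j : Fin N) → atIndex d N g (toℕ j) ≡ g j
  atIndex-toℕ (suc N) d g Fin.zero = refl
  atIndex-toℕ (suc N) d g (Fin.suc j) = atIndex-toℕ N d (λ i → g (Fin.suc i)) j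

  module _ (n k : ℕ) where
    N : ℕ
    N = n + k

    sumVertices : (h : Vertex n k → ℕ) → sum (map h (vertices n k)) ≡
      sumTo N (atIndex 0 N (λ j → h (false , j))) + sumTo N (atIndex 0 N (λ j → h (true , j)))
    sumVertices h = trans (cong sum (map-++ h (map (false ,_) (allFin N)) (map (true ,_) (allFin N))))
      (trans (sum-++ (map h (map (false ,_) (allFin N))) (map h (map (true ,_) (allFin N))))
        (cong₂ _+_ (sum-tabulate N (λ j → j) (false ,_) h) (sum-tabulate N (λ j → j) (true ,_) h)))

  ≡ᵇ-sym : ∀ a b → (a ≡ᵇ b) ≡ (b ≡ᵇ a)
  ≡ᵇ-sym zero zero = refl
  ≡ᵇ-sym zero (suc b) = refl
  ≡ᵇ-sym (suc a) zero = refl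
  ≡ᵇ-sym (suc a) (suc b) = ≡ᵇ-sym a b

  sumTo-delta : ∀ N q (h : ℕ → ℕ) → sumTo N (λ p → if q ≡ᵇ p then h p else 0) ≡ (if q <ᵇ N then h q else 0)
  sumTo-delta zero q h = refl
  sumTo-delta (suc N) zero h = trans (cong (h 0 +_) (sumTo-zeros N)) (+-identityʳ (h 0))
  sumTo-delta (suc N) (suc q) h = sumTo-delta N q (λ p → h (suc p))

  sumTo-delta' : ∀ N q (h : ℕ → ℕ) → sumTo N (λ p → if p ≡ᵇ q then h p else 0) ≡ (if q <ᵇ N then h q else 0)
  sumTo-delta' N q h = trans (sumTo-cong N (λ p _ → cong (λ b → if b then h p else 0) (≡ᵇ-sym p q))) (sumTo-delta N q h)

  -- h (q - 1) if q has a predecessor, else 0: the contribution of the left path neighbour.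
  prevTerm : ℕ → (ℕ → ℕ) → ℕ
  prevTerm zero h = 0
  prevTerm (suc q) h = h q

  lt-true : ∀ a b → a < b → (a <ᵇ b) ≡ true
  lt-true zero (suc b) _ = refl
  lt-true (suc a) (suc b) (s<s p) = lt-true a b p

  lt-false : ∀ a b → b ≤ a → (a <ᵇ b) ≡ false
  lt-false a zero _ = refl
  lt-false (suc a) (suc b) (s≤s p) = lt-false a b p

  le-true : ∀ a b → a ≤ b → (a ≤ᵇ b) ≡ true
  le-true zero b _ = refl
  le-true (suc a) b p = lt-true a b p

  le-false : ∀ a b → b < a → (a ≤ᵇ b) ≡ false
  le-false (suc a) b (s≤s p) = lt-false a b p

  sumTo-deltaPrev : ∀ N q (h : ℕ → ℕ) → q < N → sumTo N (λ p → if suc p ≡ᵇ q then h p else 0) ≡ prevTerm q h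
  sumTo-deltaPrev N zero h _ = sumTo-zeros N
  sumTo-deltaPrev N (suc q) h lt = trans (sumTo-delta' N q h) (cong (λ b → if b then h q else 0) (lt-true q N (<-trans (n<1+n q) lt)))

  atIndex-tab : ∀ N {Y : Set} (dy : Y) (F : ℕ → Y) i → i < N → atIndex dy N (λ j → F (toℕ j)) i ≡ F i
  atIndex-tab N dy F i lt = atIndex-comp N tt dy (λ _ → tt) (λ _ q → F q) i lt

  bit-and : ∀ a b → bit (a ∧ b) ≡ (if a then bit b else 0)
  bit-and true b = refl
  bit-and false b = refl

  bit-or : ∀ x p q → bit (x ∧ ((suc q ≡ᵇ p) ∨ (suc p ≡ᵇ q))) ≡
    (if suc q ≡ᵇ p then bit x else 0) + (if suc p ≡ᵇ q then bit x else 0)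
  bit-or x p q with suc q ≡ᵇ p in e1 | suc p ≡ᵇ q in e2
  ... | true | true = ⊥-elim (not-both (≡ᵇ⇒≡ (suc q) p (subst Data.Bool.T (sym e1) tt)) (≡ᵇ⇒≡ (suc p) q (subst Data.Bool.T (sym e2) tt)))
    where
    not-both : suc q ≡ p → suc p ≡ q → ⊥
    not-both refl e = <-irrefl refl (subst (λ z → q < z) e (<-trans (n<1+n q) (n<1+n (suc q))))
  ... | true | false = trans (cong bit (∧-identityʳ x)) (sym (+-identityʳ (bit x)))
  ... | false | true = cong bit (∧-identityʳ x)
  ... | false | false = cong bit (∧-zeroʳ x)

  pathDeg : ℕ → ℕ → ℕ
  pathDeg N q = (if suc q <ᵇ N then 1 else 0) + prevTerm q (λ _ → 1)

  degAt : ℕ → ℕ → ℕ → ℕ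
  degAt n N q = pathDeg N q + bit (n ≤ᵇ q)

  sum-pathNeighbours : ∀ N q → q < N → sumTo N (λ p → bit ((suc q ≡ᵇ p) ∨ (suc p ≡ᵇ q))) ≡ pathDeg N q
  sum-pathNeighbours N q lt = trans (sumTo-cong N (λ p _ → bit-or true p q))
    (trans (sumTo-+ N _ _) (cong₂ _+_ (sumTo-delta N (suc q) (λ _ → 1)) (sumTo-deltaPrev N q (λ _ → 1) lt)))

  sum-rungNeighbours : ∀ n N q → q < N → sumTo N (λ p → bit ((q ≡ᵇ p) ∧ (n ≤ᵇ q))) ≡ bit (n ≤ᵇ q)
  sum-rungNeighbours n N q lt = trans (sumTo-cong N (λ p _ → bit-and (q ≡ᵇ p) (n ≤ᵇ q)))
    (trans (sumTo-delta N q (λ _ → bit (n ≤ᵇ q))) (cong (λ b → if b then bit (n ≤ᵇ q) else 0) (lt-true q N lt)))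

  module Degrees (n k : ℕ) where
    NN : ℕ
    NN = n + k

    degree-x : ∀ j → degree n k (false , j) ≡ degAt n NN (toℕ j)
    degree-x j = trans (sumVertices n k _) (cong₂ _+_
      (trans (sumTo-cong NN (λ p lt → atIndex-tab NN 0 (λ p → bit ((suc (toℕ j) ≡ᵇ p) ∨ (suc p ≡ᵇ toℕ j))) p lt)) (sum-pathNeighbours NN (toℕ j) (toℕ<n j)))
      (trans (sumTo-cong NN (λ p lt → atIndex-tab NN 0 (λ p → bit ((toℕ j ≡ᵇ p) ∧ (n ≤ᵇ toℕ j))) p lt)) (sum-rungNeighbours n NN (toℕ j) (toℕ<n j))))

    degree-y : ∀ j → degree n k (true , j) ≡ degAt n NN (toℕ j)
    degree-y j = trans (sumVertices n k _) (trans (cong₂ _+_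
      (trans (sumTo-cong NN (λ p lt → atIndex-tab NN 0 (λ p → bit ((toℕ j ≡ᵇ p) ∧ (n ≤ᵇ toℕ j))) p lt)) (sum-rungNeighbours n NN (toℕ j) (toℕ<n j)))
      (trans (sumTo-cong NN (λ p lt → atIndex-tab NN 0 (λ p → bit ((suc (toℕ j) ≡ᵇ p) ∨ (suc p ≡ᵇ toℕ j))) p lt)) (sum-pathNeighbours NN (toℕ j) (toℕ<n j))))
      (+-comm (bit (n ≤ᵇ toℕ j)) (pathDeg NN (toℕ j))))


module CutEncoding where

  open import Defs
  open FiniteSums
  open VertexSums
  open import Data.Nat
  open import Data.Nat.Properties
  open import Data.Bool using (Bool; true; false; not; _∧_; _∨_; _xor_; if_then_else_)
  open import Data.Fin using (Fin; toℕ)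
  open import Data.Fin.Properties using (toℕ<n)
  open import Data.Product using (_,_)
  open import Relation.Binary.PropositionalEquality
  open import Data.Nat.Tactic.RingSolver

  atIndex-cong : ∀ N {X : Set} (d : X) {f g : Fin N → X} → (∀ j → f j ≡ g j) → ∀ i → atIndex d N f i ≡ atIndex d N g i
  atIndex-cong zero d h i = refl
  atIndex-cong (suc N) d h zero = h Fin.zero
  atIndex-cong (suc N) d h (suc i) = atIndex-cong N d (λ j → h (Fin.suc j)) i

  volOf : ℕ → ℕ → (ℕ → Bool) → ℕ
  volOf n N A = sumTo N (λ p → if A p then degAt n N p else 0)

  switches : ℕ → (ℕ → Bool) → ℕ
  switches N A = sumTo (pred N) (λ p → bit (A p xor A (suc p)))

  rungMismatch : ℕ → ℕ → (ℕ → Bool) → (ℕ → Bool) → ℕ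
  rungMismatch n N A B = sumTo N (λ p → if n ≤ᵇ p then bit (A p xor B p) else 0)

  cutOf : ℕ → ℕ → (ℕ → Bool) → (ℕ → Bool) → ℕ
  cutOf n N A B = switches N A + switches N B + rungMismatch n N A B

  pathBoundary : ℕ → (ℕ → Bool) → ℕ → ℕ
  pathBoundary N A q = (if suc q <ᵇ N then bit (not (A (suc q))) else 0) + prevTerm q (λ p → bit (not (A p)))

  if-0 : ∀ (a : Bool) → (if a then 0 else 0) ≡ 0
  if-0 true = refl
  if-0 false = refl

  if-+ : ∀ (a : Bool) x y → (if a then x + y else 0) ≡ (if a then x else 0) + (if a then y else 0)
  if-+ true x y = refl
  if-+ false x y = refl

  xor-split : ∀ a b → (if a then bit (not b) else 0) + (if b then bit (not a) else 0) ≡ bit (a xor b)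
  xor-split true true = refl
  xor-split true false = refl
  xor-split false true = refl
  xor-split false false = refl

  sum-pathBoundary : ∀ N A → sumTo N (λ q → if A q then pathBoundary N A q else 0) ≡ switches N A
  sum-pathBoundary zero A = refl
  sum-pathBoundary (suc L) A =
    trans (sumTo-cong (suc L) (λ q _ → if-+ (A q) (if suc q <ᵇ suc L then bit (not (A (suc q))) else 0) (prevTerm q (λ p → bit (not (A p))))))
    (trans (sumTo-+ (suc L) (λ q → if A q then (if suc q <ᵇ suc L then bit (not (A (suc q))) else 0) else 0) (λ q → if A q then prevTerm q (λ p → bit (not (A p))) else 0))
    (trans (cong₂ _+_ p1 p2)
    (trans (sym (sumTo-+ L (λ q → if A q then bit (not (A (suc q))) else 0) (λ q → if A (suc q) then bit (not (A q)) else 0))) (sumTo-cong L (λ p _ → xor-split (A p) (A (suc p)))))))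
    where
    p1 : sumTo (suc L) (λ q → if A q then (if suc q <ᵇ suc L then bit (not (A (suc q))) else 0) else 0)
         ≡ sumTo L (λ q → if A q then bit (not (A (suc q))) else 0)
    p1 = trans (sumTo-snoc L _) (trans (cong₂ _+_
           (sumTo-cong L (λ q lt → cong (λ b → if A q then (if b then bit (not (A (suc q))) else 0) else 0) (lt-true q L lt)))
           (trans (cong (λ b → if A L then (if b then bit (not (A (suc L))) else 0) else 0) (lt-false L L ≤-refl)) (if-0 (A L))))
           (+-identityʳ _))
    p2 : sumTo (suc L) (λ q → if A q then prevTerm q (λ p → bit (not (A p))) else 0)
         ≡ sumTo L (λ q → if A (suc q) then bit (not (A q)) else 0)
    p2 = cong (_+ sumTo L (λ q → if A (suc q) then bit (not (A q)) else 0)) (if-0 (A 0))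

  rung-split : ∀ a b c → bit (a ∧ (not b ∧ c)) + bit (b ∧ (not a ∧ c)) ≡ (if c then bit (a xor b) else 0)
  rung-split true true true = refl
  rung-split true true false = refl
  rung-split true false true = refl
  rung-split true false false = refl
  rung-split false true true = refl
  rung-split false true false = refl
  rung-split false false true = refl
  rung-split false false false = refl

  module Encode (n k : ℕ) (S : VSet n k) where
    open Degrees n k

    A B : ℕ → Bool
    A = atIndex false NN (λ j → S (false , j))
    B = atIndex false NN (λ j → S (true , j))

    vol-encode : vol n k S ≡ volOf n NN A + volOf n NN B
    vol-encode = trans (sumVertices n k _) (cong₂ _+_
      (sumTo-cong NN (λ p lt → trans (atIndex-cong NN 0 (λ j → cong (λ z → if S (false , j) then z else 0) (degree-x j)) p)
         (atIndex-comp NN false 0 (λ j → S (false , j)) (λ x q → if x then degAt n NN q else 0) p lt)))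
      (sumTo-cong NN (λ p lt → trans (atIndex-cong NN 0 (λ j → cong (λ z → if S (true , j) then z else 0) (degree-y j)) p)
         (atIndex-comp NN false 0 (λ j → S (true , j)) (λ x q → if x then degAt n NN q else 0) p lt))))

    volᶜ-encode : vol n k (complement n k S) ≡ volOf n NN (λ p → not (A p)) + volOf n NN (λ p → not (B p))
    volᶜ-encode = trans (sumVertices n k _) (cong₂ _+_
      (sumTo-cong NN (λ p lt → trans (atIndex-cong NN 0 (λ j → cong (λ z → if not (S (false , j)) then z else 0) (degree-x j)) p)
         (atIndex-comp NN false 0 (λ j → S (false , j)) (λ x q → if not x then degAt n NN q else 0) p lt)))
      (sumTo-cong NN (λ p lt → trans (atIndex-cong NN 0 (λ j → cong (λ z → if not (S (true , j)) then z else 0) (degree-y j)) p)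
         (atIndex-comp NN false 0 (λ j → S (true , j)) (λ x q → if not x then degAt n NN q else 0) p lt))))

    bit4 : ∀ a b c d → bit (a ∧ (b ∧ (c ∧ d))) ≡ (if c then bit (a ∧ (b ∧ d)) else 0)
    bit4 a b true d = refl
    bit4 true true false d = refl
    bit4 true false false d = refl
    bit4 false b false d = refl

    sumTo-if : ∀ L (a : Bool) f → sumTo L (λ p → if a then f p else 0) ≡ (if a then sumTo L f else 0)
    sumTo-if L true f = refl
    sumTo-if L false f = sumTo-zeros L

    sum-pathEdges : ∀ (C : ℕ → Bool) (a : Bool) q → q < NN →
      sumTo NN (λ p → bit (a ∧ (not (C p) ∧ ((suc q ≡ᵇ p) ∨ (suc p ≡ᵇ q))))) ≡ (if a then pathBoundary NN C q else 0)
    sum-pathEdges C a q lt =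
      trans (sumTo-cong NN (λ p _ → bit-and a (not (C p) ∧ ((suc q ≡ᵇ p) ∨ (suc p ≡ᵇ q)))))
      (trans (sumTo-if NN a _) (cong (λ z → if a then z else 0)
        (trans (sumTo-cong NN (λ p _ → bit-or (not (C p)) p q))
        (trans (sumTo-+ NN (λ p → if suc q ≡ᵇ p then bit (not (C p)) else 0) (λ p → if suc p ≡ᵇ q then bit (not (C p)) else 0))
          (cong₂ _+_ (sumTo-delta NN (suc q) (λ p → bit (not (C p)))) (sumTo-deltaPrev NN q (λ p → bit (not (C p))) lt))))))

    sum-rungEdges : ∀ (C : ℕ → Bool) (a : Bool) q → q < NN →
      sumTo NN (λ p → bit (a ∧ (not (C p) ∧ ((q ≡ᵇ p) ∧ (n ≤ᵇ q))))) ≡ bit (a ∧ (not (C q) ∧ (n ≤ᵇ q)))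
    sum-rungEdges C a q lt =
      trans (sumTo-cong NN (λ p _ → bit4 a (not (C p)) (q ≡ᵇ p) (n ≤ᵇ q)))
      (trans (sumTo-delta NN q (λ p → bit (a ∧ (not (C p) ∧ (n ≤ᵇ q)))))
        (cong (λ b → if b then bit (a ∧ (not (C q) ∧ (n ≤ᵇ q))) else 0) (lt-true q NN lt)))

    outEdges : Vertex n k → ℕ
    outEdges u = count (λ v → S u ∧ (not (S v) ∧ adj n k u v)) (vertices n k)

    outEdges-x : Bool → ℕ → ℕ
    outEdges-x a q = (if a then pathBoundary NN A q else 0) + bit (a ∧ (not (B q) ∧ (n ≤ᵇ q)))

    outEdges-y : Bool → ℕ → ℕ
    outEdges-y a q = bit (a ∧ (not (A q) ∧ (n ≤ᵇ q))) + (if a then pathBoundary NN B q else 0)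

    outEdges-x-eq : ∀ j → outEdges (false , j) ≡ outEdges-x (S (false , j)) (toℕ j)
    outEdges-x-eq j = trans (sumVertices n k _) (cong₂ _+_
      (trans (sumTo-cong NN (λ p lt → atIndex-comp NN false 0 (λ i → S (false , i))
          (λ x p → bit (S (false , j) ∧ (not x ∧ ((suc (toℕ j) ≡ᵇ p) ∨ (suc p ≡ᵇ toℕ j))))) p lt))
        (sum-pathEdges A (S (false , j)) (toℕ j) (toℕ<n j)))
      (trans (sumTo-cong NN (λ p lt → atIndex-comp NN false 0 (λ i → S (true , i))
          (λ x p → bit (S (false , j) ∧ (not x ∧ ((toℕ j ≡ᵇ p) ∧ (n ≤ᵇ toℕ j))))) p lt))
        (sum-rungEdges B (S (false , j)) (toℕ j) (toℕ<n j))))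

    outEdges-y-eq : ∀ j → outEdges (true , j) ≡ outEdges-y (S (true , j)) (toℕ j)
    outEdges-y-eq j = trans (sumVertices n k _) (cong₂ _+_
      (trans (sumTo-cong NN (λ p lt → atIndex-comp NN false 0 (λ i → S (false , i))
          (λ x p → bit (S (true , j) ∧ (not x ∧ ((toℕ j ≡ᵇ p) ∧ (n ≤ᵇ toℕ j))))) p lt))
        (sum-rungEdges A (S (true , j)) (toℕ j) (toℕ<n j)))
      (trans (sumTo-cong NN (λ p lt → atIndex-comp NN false 0 (λ i → S (true , i))
          (λ x p → bit (S (true , j) ∧ (not x ∧ ((suc (toℕ j) ≡ᵇ p) ∨ (suc p ≡ᵇ toℕ j))))) p lt))
        (sum-pathEdges B (S (true , j)) (toℕ j) (toℕ<n j))))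

    -- Every cut edge is counted once from its endpoint in S: path edges through
    -- pathBoundary, rungs through the two one-sided mismatch indicators.
    cut-encode : cutC n k S ≡ cutOf n NN A B
    cut-encode = begin
      cutC n k S
        ≡⟨ sumVertices n k outEdges ⟩
      sumTo NN (atIndex 0 NN (λ j → outEdges (false , j))) + sumTo NN (atIndex 0 NN (λ j → outEdges (true , j)))
        ≡⟨ cong₂ _+_ x-rail y-rail ⟩
      (pathA + rungA) + (rungB + pathB)
        ≡⟨ rearrange pathA pathB rungA rungB ⟩
      (pathA + pathB) + (rungA + rungB)
        ≡⟨ cong₂ _+_ (cong₂ _+_ (sum-pathBoundary NN A) (sum-pathBoundary NN B)) rungs ⟩
      cutOf n NN A B ∎
      where
      open ≡-Reasoning
      pathA pathB rungA rungB : ℕ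
      pathA = sumTo NN (λ p → if A p then pathBoundary NN A p else 0)
      pathB = sumTo NN (λ p → if B p then pathBoundary NN B p else 0)
      rungA = sumTo NN (λ p → bit (A p ∧ (not (B p) ∧ (n ≤ᵇ p))))
      rungB = sumTo NN (λ p → bit (B p ∧ (not (A p) ∧ (n ≤ᵇ p))))
      x-rail : sumTo NN (atIndex 0 NN (λ j → outEdges (false , j))) ≡ pathA + rungA
      x-rail = trans (sumTo-cong NN (λ p lt → trans (atIndex-cong NN 0 outEdges-x-eq p)
                       (atIndex-comp NN false 0 (λ j → S (false , j)) outEdges-x p lt)))
                 (sumTo-+ NN _ _)
      y-rail : sumTo NN (atIndex 0 NN (λ j → outEdges (true , j))) ≡ rungB + pathB
      y-rail = trans (sumTo-cong NN (λ p lt → trans (atIndex-cong NN 0 outEdges-y-eq p)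
                       (atIndex-comp NN false 0 (λ j → S (true , j)) outEdges-y p lt)))
                 (sumTo-+ NN _ _)
      rungs : rungA + rungB ≡ rungMismatch n NN A B
      rungs = trans (sym (sumTo-+ NN _ _)) (sumTo-cong NN (λ p _ → rung-split (A p) (B p) (n ≤ᵇ p)))
      rearrange : ∀ a b c d → a + c + (d + b) ≡ a + b + (c + d)
      rearrange = solve-∀

module BooleanRuns where

  open FiniteSums
  open import Data.Nat
  open import Data.Nat.Properties
  open import Data.Bool using (Bool; true; false; not; _∧_; _∨_; _xor_; if_then_else_)
  open import Data.Bool.Properties public using (not-involutive; xor-same; xor-comm)
  open import Data.Product using (_×_; _,_; Σ)
  open import Relation.Binary.PropositionalEquality

  xor-f : ∀ a b → (a xor b) ≡ false → b ≡ a
  xor-f true true _ = refl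
  xor-f false false _ = refl
  xor-f true false ()
  xor-f false true ()

  xor-t : ∀ a b → (a xor b) ≡ true → b ≡ not a
  xor-t true false _ = refl
  xor-t false true _ = refl
  xor-t true true ()
  xor-t false false ()

  not-xor : ∀ a b → (not a xor not b) ≡ (a xor b)
  not-xor true true = refl
  not-xor true false = refl
  not-xor false true = refl
  not-xor false false = refl

  if-tf : ∀ b → (if b then true else false) ≡ b
  if-tf true = refl
  if-tf false = refl

  bitz : ∀ b → bit b ≡ 0 → b ≡ false
  bitz false _ = refl
  bitz true ()

  switchesUpTo : ℕ → (ℕ → Bool) → ℕ
  switchesUpTo L A = sumTo L (λ p → bit (A p xor A (suc p)))

  noSwitch-const : ∀ L A → switchesUpTo L A ≡ 0 → ∀ p → p ≤ L → A p ≡ A 0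
  noSwitch-const L A e zero _ = refl
  noSwitch-const (suc L) A e (suc p) (s≤s q) =
    trans (noSwitch-const L (λ i → A (suc i)) (m+n≡0⇒n≡0 (bit (A 0 xor A 1)) e) p q)
          (xor-f (A 0) (A 1) (bitz _ (m+n≡0⇒m≡0 (bit (A 0 xor A 1)) e)))

  StepShape : ℕ → (ℕ → Bool) → Set
  StepShape L A = Σ ℕ λ j → 1 ≤ j × j ≤ L × (∀ p → p ≤ L → A p ≡ (if p <ᵇ j then A 0 else not (A 0)))

  oneSwitch-step : ∀ L A → switchesUpTo L A ≡ 1 → StepShape L A
  oneSwitch-step zero A ()
  oneSwitch-step (suc L) A e with A 0 xor A 1 in x
  ... | true = 1 , ≤-refl , s≤s z≤n , f
    where
    f : ∀ p → p ≤ suc L → A p ≡ (if p <ᵇ 1 then A 0 else not (A 0))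
    f zero _ = refl
    f (suc p) (s≤s q) = trans (noSwitch-const L (λ i → A (suc i)) (suc-injective e) p q) (xor-t (A 0) (A 1) x)
  ... | false with oneSwitch-step L (λ i → A (suc i)) e
  ... | j , a , b , f = suc j , s≤s z≤n , s≤s b , g
    where
    g : ∀ p → p ≤ suc L → A p ≡ (if p <ᵇ suc j then A 0 else not (A 0))
    g zero _ = refl
    g (suc p) (s≤s q) = trans (f p q) (cong (λ z → if p <ᵇ j then z else not z) (xor-f (A 0) (A 1) x))

  BlockShape : ℕ → (ℕ → Bool) → Set
  BlockShape L A = Σ ℕ λ j → Σ ℕ λ l → 1 ≤ j × j < l × l ≤ L ×
    (∀ p → p ≤ L → A p ≡ (if p <ᵇ j then A 0 else (if p <ᵇ l then not (A 0) else A 0)))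

  twoSwitches-block : ∀ L A → switchesUpTo L A ≡ 2 → BlockShape L A
  twoSwitches-block zero A ()
  twoSwitches-block (suc L) A e with A 0 xor A 1 in x
  ... | true with oneSwitch-step L (λ i → A (suc i)) (suc-injective e)
  ... | j , a , b , f = 1 , suc j , ≤-refl , s≤s a , s≤s b , g
    where
    g : ∀ p → p ≤ suc L → A p ≡ (if p <ᵇ 1 then A 0 else (if p <ᵇ suc j then not (A 0) else A 0))
    g zero _ = refl
    g (suc p) (s≤s q) = trans (f p q) (trans (cong (λ z → if p <ᵇ j then z else not z) (xor-t (A 0) (A 1) x))
      (cong (λ z → if p <ᵇ j then not (A 0) else z) (not-involutive (A 0))))
  twoSwitches-block (suc L) A e | false with twoSwitches-block L (λ i → A (suc i)) e
  ... | j , l , a , b , c , f = suc j , suc l , s≤s z≤n , s≤s b , s≤s c , g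
    where
    g : ∀ p → p ≤ suc L → A p ≡ (if p <ᵇ suc j then A 0 else (if p <ᵇ suc l then not (A 0) else A 0))
    g zero _ = refl
    g (suc p) (s≤s q) = trans (f p q) (cong (λ z → if p <ᵇ j then z else (if p <ᵇ l then not z else z)) (xor-f (A 0) (A 1) x))


module CutClassification where

  open FiniteSums
  open VertexSums using (degAt; prevTerm; lt-true; lt-false; le-true; le-false)
  open CutEncoding using (volOf; switches; rungMismatch; cutOf; if-0)
  open BooleanRuns
  open import Data.Nat
  open import Data.Nat.Properties
  open import Data.Bool using (Bool; true; false; not; _∧_; _∨_; _xor_; if_then_else_)
  open import Data.Product using (_×_; _,_; Σ; proj₁; proj₂)
  open import Data.Sum using (_⊎_; inj₁; inj₂; swap)
  open import Data.Empty
  open import Relation.Nullary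
  open import Relation.Binary.PropositionalEquality
  open import Relation.Binary.Definitions using (tri<; tri≈; tri>)

  lt-pred : ∀ {a b} → a < b → a ≤ pred b
  lt-pred (s≤s p) = p

  pred-lt : ∀ {a b} → a < b → pred b < b
  pred-lt (s≤s _) = ≤-refl

  switches-not : ∀ N A → switches N (λ p → not (A p)) ≡ switches N A
  switches-not N A = sumTo-cong (pred N) (λ p _ → cong bit (not-xor (A p) (A (suc p))))

  rungMismatch-not : ∀ n N A B → rungMismatch n N (λ p → not (A p)) (λ p → not (B p)) ≡ rungMismatch n N A B
  rungMismatch-not n N A B = sumTo-cong N (λ p _ → cong (λ z → if n ≤ᵇ p then bit z else 0) (not-xor (A p) (B p)))

  rungMismatch-swap : ∀ n N A B → rungMismatch n N B A ≡ rungMismatch n N A B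
  rungMismatch-swap n N A B = sumTo-cong N (λ p _ → cong (λ z → if n ≤ᵇ p then bit z else 0) (xor-comm (B p) (A p)))

  cutOf-not : ∀ n N A B → cutOf n N (λ p → not (A p)) (λ p → not (B p)) ≡ cutOf n N A B
  cutOf-not n N A B = cong₂ _+_ (cong₂ _+_ (switches-not N A) (switches-not N B)) (rungMismatch-not n N A B)

  cutOf-swap : ∀ n N A B → cutOf n N B A ≡ cutOf n N A B
  cutOf-swap n N A B = cong₂ _+_ (+-comm (switches N B) (switches N A)) (rungMismatch-swap n N A B)

  ifle : ∀ (a b : Bool) d → (a ≡ true → b ≡ true) → (if a then d else 0) ≤ (if b then d else 0)
  ifle true b d h rewrite h refl = ≤-refl
  ifle false b d h = z≤n

  notif : ∀ (b : Bool) d → (if not b then d else 0) ≡ (if b then 0 else d)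
  notif true d = refl
  notif false d = refl

  -- The ladder with positions 0 … L and rungs from position n on.
  -- D j is the volume of the first j positions of one rail, u = D n that of a pendant path.
  module Shapes (n L : ℕ) (n1 : 1 ≤ n) (nL : n < L) where
    N : ℕ
    N = suc L

    D : ℕ → ℕ
    D j = sumTo j (degAt n N)

    V : (ℕ → Bool) → ℕ
    V A = volOf n N A

    u : ℕ
    u = D n

    -- Possible volumes of a side of a cut of size 2: at most two pendant-path volumes,
    -- a pendant path plus the first rung position, a balanced prefix of both rails, or
    -- (only when there are exactly two rungs) a whole rail.
    TwoCutSide : ℕ → Set
    TwoCutSide v = v ≤ u + u ⊎ v ≡ D (suc n) ⊎ (Σ ℕ λ j → n ≤ j × j ≤ L × v ≡ D j + D j) ⊎ (L ≡ suc n × v ≡ D N)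

    CutShape : ℕ → ℕ → ℕ → Set
    CutShape c v w = 3 ≤ c ⊎ (c ≡ 1 × (v ≤ u ⊎ w ≤ u)) ⊎ (c ≡ 2 × (TwoCutSide v ⊎ TwoCutSide w))

    -- S ≠ ∅ and S ≠ V, read on the rails.
    Nontrivial : (ℕ → Bool) → (ℕ → Bool) → Set
    Nontrivial A B = (Σ ℕ λ p → p ≤ L × (A p ≡ true ⊎ B p ≡ true)) × (Σ ℕ λ p → p ≤ L × (A p ≡ false ⊎ B p ≡ false))

    CutShape-swap : ∀ {c v w} → CutShape c v w → CutShape c w v
    CutShape-swap (inj₁ x) = inj₁ x
    CutShape-swap (inj₂ (inj₁ (e , inj₁ x))) = inj₂ (inj₁ (e , inj₂ x))
    CutShape-swap (inj₂ (inj₁ (e , inj₂ x))) = inj₂ (inj₁ (e , inj₁ x))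
    CutShape-swap (inj₂ (inj₂ (e , inj₁ x))) = inj₂ (inj₂ (e , inj₂ x))
    CutShape-swap (inj₂ (inj₂ (e , inj₂ x))) = inj₂ (inj₂ (e , inj₁ x))

    CutShape-cong : ∀ {c v w c' v' w'} → c ≡ c' → v ≡ v' → w ≡ w' → CutShape c v w → CutShape c' v' w'
    CutShape-cong refl refl refl x = x

    sumTo-prefix : ∀ j → j ≤ N → sumTo N (λ p → if p <ᵇ j then degAt n N p else 0) ≡ D j
    sumTo-prefix j jN = +-cancelʳ-≡ 0 _ _ (trans (cong (sumTo N (λ p → if p <ᵇ j then degAt n N p else 0) +_) (sym (sumTo-zeros j)))
        (trans (sumTo-splitAt N j (degAt n N) (λ _ → 0) jN) (cong (D j +_) (sumTo-zeros N))))

    vol-prefix : ∀ A j → j ≤ N → (∀ p → p ≤ L → A p ≡ (p <ᵇ j)) → V A ≡ D j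
    vol-prefix A j jN h = trans (sumTo-cong N (λ p lt → cong (λ z → if z then degAt n N p else 0) (h p (≤-pred lt)))) (sumTo-prefix j jN)

    vol-empty : ∀ A → (∀ p → p ≤ L → A p ≡ false) → V A ≡ 0
    vol-empty A h = sumTo-vanish N _ (λ p lt → cong (λ z → if z then degAt n N p else 0) (h p (≤-pred lt)))

    vol-full : ∀ A → (∀ p → p ≤ L → A p ≡ true) → V A ≡ D N
    vol-full A h = sumTo-cong N (λ p lt → cong (λ z → if z then degAt n N p else 0) (h p (≤-pred lt)))

    vol-suffix : ∀ A j → j ≤ N → (∀ p → p ≤ L → A p ≡ not (p <ᵇ j)) → V A + D j ≡ D N
    vol-suffix A j jN h = trans (cong (_+ D j) (sumTo-cong N (λ p lt → trans (cong (λ z → if z then degAt n N p else 0) (h p (≤-pred lt))) (notif (p <ᵇ j) (degAt n N p)))))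
      (trans (sumTo-splitAt N j (λ _ → 0) (degAt n N) jN) (cong (_+ D N) (sumTo-zeros j)))

    D-mono : ∀ {j l} → j ≤ l → D j ≤ D l
    D-mono {j} {l} le = sumTo-monoˡ j l (degAt n N) le

    prv1 : ∀ q → 1 ≤ q → prevTerm q (λ _ → 1) ≡ 1
    prv1 (suc q) _ = refl

    -- The last position has degree 2 and the first has degree 1, so u ≥ 1.
    degAt-last : degAt n N L ≡ 2
    degAt-last = cong₂ _+_ (cong₂ _+_ (cong (λ b → if b then 1 else 0) (lt-false L L ≤-refl)) (prv1 L (≤-trans n1 (<⇒≤ nL))))
                    (cong bit (le-true n L (<⇒≤ nL)))

    1≤u : 1 ≤ u
    1≤u = ≤-trans (subst (1 ≤_) (sym (cong (λ b → (if b then 1 else 0) + 0 + bit (n ≤ᵇ 0)) (lt-true 0 L (≤-trans n1 (<⇒≤ nL))))) (m≤m+n 1 _))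
                 (term≤sumTo n (degAt n N) 0 n1)

    mismatchAt : (ℕ → Bool) → (ℕ → Bool) → ℕ → ℕ
    mismatchAt A B p = if n ≤ᵇ p then bit (A p xor B p) else 0

    mismatchAt-1 : ∀ A B p → n ≤ p → (A p xor B p) ≡ true → mismatchAt A B p ≡ 1
    mismatchAt-1 A B p np x rewrite le-true n p np | x = refl

    rungMismatch≥1 : ∀ A B p → n ≤ p → p ≤ L → (A p xor B p) ≡ true → 1 ≤ rungMismatch n N A B
    rungMismatch≥1 A B p np pL x = ≤-trans (≤-reflexive (sym (mismatchAt-1 A B p np x))) (term≤sumTo N (mismatchAt A B) p (s≤s pL))

    rungMismatch≥2 : ∀ A B p q → n ≤ p → p < q → q ≤ L → (A p xor B p) ≡ true → (A q xor B q) ≡ true → 2 ≤ rungMismatch n N A B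
    rungMismatch≥2 A B p q np pq qL x y = ≤-trans (≤-reflexive (sym (cong₂ _+_ (mismatchAt-1 A B p np x) (mismatchAt-1 A B q (≤-trans np (<⇒≤ pq)) y))))
      (twoTerms≤sumTo N (mismatchAt A B) p q pq (s≤s qL))

    rungMismatch-none : ∀ A B → (∀ p → n ≤ p → p ≤ L → (A p xor B p) ≡ false) → rungMismatch n N A B ≡ 0
    rungMismatch-none A B h = sumTo-vanish N (mismatchAt A B) f
      where
      f : ∀ p → p < N → mismatchAt A B p ≡ 0
      f p lt with n ≤? p
      ... | yes np rewrite le-true n p np | h p np (≤-pred lt) = refl
      ... | no np rewrite le-false n p (≰⇒> np) = refl

    rungMismatch0⇒agree : ∀ A B → rungMismatch n N A B ≡ 0 → ∀ p → n ≤ p → p ≤ L → (A p xor B p) ≡ false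
    rungMismatch0⇒agree A B e p np pL with A p xor B p in x
    ... | false = refl
    ... | true = ⊥-elim (<-irrefl refl (subst (1 ≤_) e (rungMismatch≥1 A B p np pL x)))

    HasCutShape : (ℕ → Bool) → (ℕ → Bool) → Set
    HasCutShape A B = CutShape (cutOf n N A B) (V A + V B) (V (λ p → not (A p)) + V (λ p → not (B p)))

    3≤3+ : ∀ {c K} → c ≡ 3 + K → 3 ≤ c
    3≤3+ refl = s≤s (s≤s (s≤s z≤n))

    -- Both rails constant (A = V-side, B = ∅-side): the cut consists of all k rungs,
    -- so either k ≥ 3 or k = 2 and S is a whole rail.
    shape-noSwitches : ∀ A B → A 0 ≡ true → switchesUpTo L A ≡ 0 → switchesUpTo L B ≡ 0 → Nontrivial A B → HasCutShape A B
    shape-noSwitches A B a0 eA eB ne = go (B 0) refl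
      where
      hA : ∀ p → p ≤ L → A p ≡ true
      hA p pL = trans (noSwitch-const L A eA p pL) a0
      nN : n ≤ N
      nN = ≤-trans (<⇒≤ nL) (n≤1+n L)
      2≤k : 2 ≤ N ∸ n
      2≤k = subst (λ z → z ≤ N ∸ n) (m+n∸n≡m 2 n) (∸-monoˡ-≤ n (s≤s nL))
      byRungCount : ∀ K → N ∸ n ≡ K → 2 ≤ K → cutOf n N A B ≡ K → V A + V B ≡ D N → HasCutShape A B
      byRungCount (suc (suc zero)) eK _ cv veq = inj₂ (inj₂ (cv , inj₁ (inj₂ (inj₂ (inj₂ (Leq , veq))))))
        where
        Leq : L ≡ suc n
        Leq = suc-injective (trans (sym (m+[n∸m]≡n nN)) (trans (cong (n +_) eK) (+-comm n 2)))
      byRungCount (suc (suc (suc K))) eK _ cv veq = inj₁ (3≤3+ cv)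
      byRungCount (suc zero) eK (s≤s ()) cv veq
      go : ∀ β → B 0 ≡ β → HasCutShape A B
      go true b0 = ⊥-elim (contra (proj₂ ne))
        where
        contra : (Σ ℕ λ p → p ≤ L × (A p ≡ false ⊎ B p ≡ false)) → ⊥
        contra (p , pL , inj₁ x) with trans (sym x) (hA p pL)
        ... | ()
        contra (p , pL , inj₂ x) with trans (sym x) (trans (noSwitch-const L B eB p pL) b0)
        ... | ()
      go false b0 = byRungCount (N ∸ n) refl 2≤k (cong₂ _+_ (cong₂ _+_ eA eB) allRungsCut)
          (trans (cong₂ _+_ (vol-full A hA) (vol-empty B hB)) (+-identityʳ (D N)))
        where
        hB : ∀ p → p ≤ L → B p ≡ false
        hB p pL = trans (noSwitch-const L B eB p pL) b0
        allRungsCut : rungMismatch n N A B ≡ N ∸ n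
        allRungsCut = trans (sumTo-cong N (λ p lt → cong (λ z → if n ≤ᵇ p then bit z else 0) (cong₂ _xor_ (hA p (≤-pred lt)) (hB p (≤-pred lt)))))
          (subst (λ M → sumTo M (λ p → if n ≤ᵇ p then 1 else 0) ≡ N ∸ n) (m+[n∸m]≡n nN) (sumTo-indicator≥ n (N ∸ n)))

    ¬3≤1+⇒≤1 : ∀ {m} → ¬ 3 ≤ 1 + m → m ≤ 1
    ¬3≤1+⇒≤1 h = ≤-pred (≤-pred (≰⇒> h))

    -- A prefix [0, j) on rail x and nothing on rail y, with at most one rung cut:
    -- either j ≤ n (cut 1, S inside the pendant path) or j = n + 1 (cut 2, volume D (n + 1)).
    shape-prefixEmpty : ∀ A B j → j ≤ L → (∀ p → p ≤ L → A p ≡ (p <ᵇ j)) → (∀ p → p ≤ L → B p ≡ false) →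
      cutOf n N A B ≡ 1 + rungMismatch n N A B → rungMismatch n N A B ≤ 1 → HasCutShape A B
    shape-prefixEmpty A B j jL pA pB cv mle with j ≤? n
    ... | yes jn = inj₂ (inj₁ (trans cv (cong suc m0) , inj₁ vle))
      where
      m0 : rungMismatch n N A B ≡ 0
      m0 = rungMismatch-none A B (λ p np' pL → cong₂ _xor_ (trans (pA p pL) (lt-false p j (≤-trans jn np'))) (pB p pL))
      vle : V A + V B ≤ u
      vle = subst (_≤ u) (sym (trans (cong₂ _+_ (vol-prefix A j (≤-trans jL (n≤1+n L)) pA) (vol-empty B pB)) (+-identityʳ (D j)))) (D-mono jn)
    ... | no jn = inj₂ (inj₂ (trans cv (cong suc m1) , inj₁ (inj₂ (inj₁ veq))))
      where
      nj : n < j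
      nj = ≰⇒> jn
      cut-n : (A n xor B n) ≡ true
      cut-n = cong₂ _xor_ (trans (pA n (<⇒≤ nL)) (lt-true n j nj)) (pB n (<⇒≤ nL))
      m1 : rungMismatch n N A B ≡ 1
      m1 = ≤-antisym mle (rungMismatch≥1 A B n ≤-refl (<⇒≤ nL) cut-n)
      jeq : j ≡ suc n
      jeq with suc n <? j
      ... | no h = ≤-antisym (≮⇒≥ h) nj
      ... | yes h = ⊥-elim (<-irrefl refl (≤-trans (rungMismatch≥2 A B n (suc n) ≤-refl ≤-refl nL cut-n
               (cong₂ _xor_ (trans (pA (suc n) nL) (lt-true (suc n) j h)) (pB (suc n) nL))) mle))
      veq : V A + V B ≡ D (suc n)
      veq = trans (cong₂ _+_ (vol-prefix A j (≤-trans jL (n≤1+n L)) pA) (vol-empty B pB)) (trans (+-identityʳ (D j)) (cong D jeq))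

    -- A prefix [0, j) on rail x and all of rail y, with at most one rung cut: then j = L and
    -- Sᶜ is the last vertex of rail x, of volume 2.
    shape-prefixFull : ∀ A B j → j ≤ L → (∀ p → p ≤ L → A p ≡ (p <ᵇ j)) → (∀ p → p ≤ L → B p ≡ true) →
      cutOf n N A B ≡ 1 + rungMismatch n N A B → rungMismatch n N A B ≤ 1 → HasCutShape A B
    shape-prefixFull A B j jL pA pB cv mle = inj₂ (inj₂ (trans cv (cong suc m1) , inj₂ (inj₁ wle)))
      where
      xL : (A L xor B L) ≡ true
      xL = cong₂ _xor_ (trans (pA L ≤-refl) (lt-false L j jL)) (pB L ≤-refl)
      m1 : rungMismatch n N A B ≡ 1
      m1 = ≤-antisym mle (rungMismatch≥1 A B L (<⇒≤ nL) ≤-refl xL)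
      jeq : j ≡ L
      jeq with j <? L
      ... | no h = ≤-antisym jL (≮⇒≥ h)
      ... | yes h = ⊥-elim (<-irrefl refl (≤-trans (rungMismatch≥2 A B (pred L) L (lt-pred nL) (pred-lt nL) ≤-refl
               (cong₂ _xor_ (trans (pA (pred L) (<⇒≤ (pred-lt nL))) (lt-false (pred L) j (lt-pred h))) (pB (pred L) (<⇒≤ (pred-lt nL))))
               xL) mle))
      vA : V (λ p → not (A p)) ≡ 2
      vA = trans (+-cancelˡ-≡ (D L) _ _ (trans (+-comm (D L) _) (trans (subst (λ z → V (λ p → not (A p)) + D z ≡ D N) jeq
              (vol-suffix (λ p → not (A p)) j (≤-trans jL (n≤1+n L)) (λ p pL → cong not (pA p pL)))) (sumTo-snoc L (degAt n N))))) degAt-last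
      wle : V (λ p → not (A p)) + V (λ p → not (B p)) ≤ u + u
      wle = subst (_≤ u + u) (sym (cong₂ _+_ vA (vol-empty (λ p → not (B p)) (λ p pL → cong not (pB p pL)))))
              (+-mono-≤ 1≤u 1≤u)

    shape-oneSwitch : ∀ A B → A 0 ≡ true → switchesUpTo L A ≡ 1 → switchesUpTo L B ≡ 0 → ¬ 3 ≤ cutOf n N A B → HasCutShape A B
    shape-oneSwitch A B a0 eA eB np with oneSwitch-step L A eA
    ... | j , _ , jL , fA = onRailY (B 0) refl
      where
      pA : ∀ p → p ≤ L → A p ≡ (p <ᵇ j)
      pA p pL = trans (fA p pL) (trans (cong (λ z → if p <ᵇ j then z else not z) a0) (if-tf (p <ᵇ j)))
      cv : cutOf n N A B ≡ 1 + rungMismatch n N A B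
      cv = cong₂ _+_ (cong₂ _+_ eA eB) refl
      mle : rungMismatch n N A B ≤ 1
      mle = ¬3≤1+⇒≤1 (λ h → np (subst (3 ≤_) (sym cv) h))
      onRailY : ∀ β → B 0 ≡ β → HasCutShape A B
      onRailY false b0 = shape-prefixEmpty A B j jL pA (λ p pL → trans (noSwitch-const L B eB p pL) b0) cv mle
      onRailY true b0 = shape-prefixFull A B j jL pA (λ p pL → trans (noSwitch-const L B eB p pL) b0) cv mle

    ¬3≤2+⇒0 : ∀ {m} → ¬ 3 ≤ 2 + m → m ≡ 0
    ¬3≤2+⇒0 h = n≤0⇒n≡0 (≤-pred (≤-pred (≤-pred (≰⇒> h))))

    block-complement⊆prefix : ∀ (x y : Bool) → not (if x then true else (if y then false else true)) ≡ true → y ≡ true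
    block-complement⊆prefix true y ()
    block-complement⊆prefix false true _ = refl
    block-complement⊆prefix false false ()

    -- A has a block removed, B constant: no rung may be cut, so B = V and the block lies in
    -- the pendant path; the complement has volume ≤ u.
    shape-twoSwitchesOneSide : ∀ A B → A 0 ≡ true → switchesUpTo L A ≡ 2 → switchesUpTo L B ≡ 0 → ¬ 3 ≤ cutOf n N A B → HasCutShape A B
    shape-twoSwitchesOneSide A B a0 eA eB np with twoSwitches-block L A eA
    ... | j , zero , j1 , () , lL , fA
    ... | j , suc l' , j1 , jl , lL , fA = inj₂ (inj₂ (trans cv (cong (2 +_) m0) , inj₂ (inj₁ wle)))
      where
      l = suc l'
      pA : ∀ p → p ≤ L → A p ≡ (if p <ᵇ j then true else (if p <ᵇ l then false else true))
      pA p pL = trans (fA p pL) (cong (λ z → if p <ᵇ j then z else (if p <ᵇ l then not z else z)) a0)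
      cv : cutOf n N A B ≡ 2 + rungMismatch n N A B
      cv = cong₂ _+_ (cong₂ _+_ eA eB) refl
      m0 : rungMismatch n N A B ≡ 0
      m0 = ¬3≤2+⇒0 (λ h → np (subst (3 ≤_) (sym cv) h))
      jL : j ≤ L
      jL = ≤-trans (<⇒≤ jl) lL
      AL : A L ≡ true
      AL = trans (pA L ≤-refl) (trans (cong (λ z → if z then true else (if L <ᵇ l then false else true)) (lt-false L j jL))
                                      (cong (λ z → if z then false else true) (lt-false L l lL)))
      BL : B L ≡ true
      BL = trans (xor-f (A L) (B L) (rungMismatch0⇒agree A B m0 L (<⇒≤ nL) ≤-refl)) AL
      hB : ∀ p → p ≤ L → B p ≡ true
      hB p pL = trans (noSwitch-const L B eB p pL) (trans (sym (noSwitch-const L B eB L ≤-refl)) BL)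
      ln : l ≤ n
      ln with n ≤? l'
      ... | no h = ≰⇒> h
      ... | yes h = ⊥-elim (bad (trans (sym (rungMismatch0⇒agree A B m0 l' h (≤-trans (n≤1+n l') lL)))
                     (cong₂ _xor_ (trans (pA l' (≤-trans (n≤1+n l') lL))
                         (trans (cong (λ z → if z then true else (if l' <ᵇ l then false else true)) (lt-false l' j (≤-pred jl)))
                                (cong (λ z → if z then false else true) (lt-true l' l ≤-refl))))
                       (hB l' (≤-trans (n≤1+n l') lL)))))
        where
        bad : false ≡ true → ⊥
        bad ()
      vA : V (λ p → not (A p)) ≤ D l
      vA = ≤-trans (sumTo-mono N (λ p lt → ifle (not (A p)) (p <ᵇ l) (degAt n N p)
             (λ e → block-complement⊆prefix (p <ᵇ j) (p <ᵇ l) (subst (λ z → not z ≡ true) (pA p (≤-pred lt)) e))))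
             (≤-reflexive (sumTo-prefix l (≤-trans lL (n≤1+n L))))
      wle : V (λ p → not (A p)) + V (λ p → not (B p)) ≤ u + u
      wle = ≤-trans (≤-reflexive (trans (cong (V (λ p → not (A p)) +_) (vol-empty (λ p → not (B p)) (λ p pL → cong not (hB p pL))))
                     (+-identityʳ _)))
            (≤-trans (≤-trans vA (D-mono ln)) (m≤m+n u u))

    not-false : ∀ b → not b ≡ false → b ≡ true
    not-false true _ = refl
    not-false false ()

    agreeOnRungs⇒≤n : ∀ j l → j < l → l ≤ L → (∀ p → n ≤ p → p ≤ L → (p <ᵇ j) ≡ (p <ᵇ l)) → l ≤ n
    agreeOnRungs⇒≤n j zero () lL h
    agreeOnRungs⇒≤n j (suc l') jl lL h with n ≤? l'
    ... | no nl = ≰⇒> nl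
    ... | yes nl = ⊥-elim (bad (trans (sym (lt-false l' j (≤-pred jl))) (trans (h l' nl (≤-trans (n≤1+n l') lL)) (lt-true l' (suc l') ≤-refl))))
      where
      bad : false ≡ true → ⊥
      bad ()

    -- A, B both prefixes and no rung cut: either both end in the pendant paths or they are
    -- the same prefix [0, j) with j ≥ n.
    shape-oneSwitchEach : ∀ A B → A 0 ≡ true → switchesUpTo L A ≡ 1 → switchesUpTo L B ≡ 1 → ¬ 3 ≤ cutOf n N A B → HasCutShape A B
    shape-oneSwitchEach A B a0 eA eB np with oneSwitch-step L A eA | oneSwitch-step L B eB
    ... | j , j1 , jL , fA | l , l1 , lL , fB = inj₂ (inj₂ (trans cv (cong (2 +_) m0) , inj₁ g2))
      where
      pA : ∀ p → p ≤ L → A p ≡ (p <ᵇ j)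
      pA p pL = trans (fA p pL) (trans (cong (λ z → if p <ᵇ j then z else not z) a0) (if-tf (p <ᵇ j)))
      cv : cutOf n N A B ≡ 2 + rungMismatch n N A B
      cv = cong₂ _+_ (cong₂ _+_ eA eB) refl
      m0 : rungMismatch n N A B ≡ 0
      m0 = ¬3≤2+⇒0 (λ h → np (subst (3 ≤_) (sym cv) h))
      b0 : B 0 ≡ true
      b0 = not-false (B 0) (trans (sym (trans (fB L ≤-refl) (cong (λ z → if z then B 0 else not (B 0)) (lt-false L l lL))))
                   (trans (xor-f (A L) (B L) (rungMismatch0⇒agree A B m0 L (<⇒≤ nL) ≤-refl)) (trans (pA L ≤-refl) (lt-false L j jL))))
      pB : ∀ p → p ≤ L → B p ≡ (p <ᵇ l)
      pB p pL = trans (fB p pL) (trans (cong (λ z → if p <ᵇ l then z else not z) b0) (if-tf (p <ᵇ l)))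
      eqp : ∀ p → n ≤ p → p ≤ L → (p <ᵇ j) ≡ (p <ᵇ l)
      eqp p np' pL = trans (sym (pA p pL)) (trans (sym (xor-f (A p) (B p) (rungMismatch0⇒agree A B m0 p np' pL))) (pB p pL))
      veq : V A + V B ≡ D j + D l
      veq = cong₂ _+_ (vol-prefix A j (≤-trans jL (n≤1+n L)) pA) (vol-prefix B l (≤-trans lL (n≤1+n L)) pB)
      g2 : TwoCutSide (V A + V B)
      g2 with <-cmp j l
      ... | tri< jl _ _ = inj₁ (subst (_≤ u + u) (sym veq) (+-mono-≤ (D-mono (≤-trans (<⇒≤ jl) ln)) (D-mono ln)))
        where
        ln = agreeOnRungs⇒≤n j l jl lL eqp
      ... | tri> _ _ lj = inj₁ (subst (_≤ u + u) (sym veq) (+-mono-≤ (D-mono jn) (D-mono (≤-trans (<⇒≤ lj) jn))))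
        where
        jn = agreeOnRungs⇒≤n l j lj jL (λ p a b → sym (eqp p a b))
      ... | tri≈ _ refl _ with j ≤? n
      ... | yes jn = inj₁ (subst (_≤ u + u) (sym veq) (+-mono-≤ (D-mono jn) (D-mono jn)))
      ... | no jn = inj₂ (inj₂ (inj₁ (j , <⇒≤ (≰⇒> jn) , jL , veq)))

    -- With A 0 = true and at least as many switches in A as in B, a cut below 3 leaves only
    -- the four cases above.
    shape-normalised : ∀ A B → A 0 ≡ true → switchesUpTo L B ≤ switchesUpTo L A → Nontrivial A B → HasCutShape A B
    shape-normalised A B a0 le ne with 3 ≤? cutOf n N A B
    ... | yes p = inj₁ p
    ... | no np = disp (switchesUpTo L A) (switchesUpTo L B) refl refl le
      where
      disp : ∀ a b → switchesUpTo L A ≡ a → switchesUpTo L B ≡ b → b ≤ a → HasCutShape A B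
      disp 0 0 ea eb _ = shape-noSwitches A B a0 ea eb ne
      disp 1 0 ea eb _ = shape-oneSwitch A B a0 ea eb np
      disp 2 0 ea eb _ = shape-twoSwitchesOneSide A B a0 ea eb np
      disp 1 1 ea eb _ = shape-oneSwitchEach A B a0 ea eb np
      disp 0 (suc b) ea eb ()
      disp 1 (suc (suc b)) ea eb (s≤s ())
      disp 2 (suc b) ea eb _ = ⊥-elim (np (3≤3+ (cong₂ _+_ (cong₂ _+_ ea eb) refl)))
      disp (suc (suc (suc a))) b ea eb _ = ⊥-elim (np (3≤3+ (cong₂ _+_ (cong₂ _+_ ea eb) refl)))

    V-notnot : ∀ A → V (λ p → not (not (A p))) ≡ V A
    V-notnot A = sumTo-cong N (λ p _ → cong (λ z → if z then degAt n N p else 0) (not-involutive (A p)))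

    nontrivial-not : ∀ A B → Nontrivial A B → Nontrivial (λ p → not (A p)) (λ p → not (B p))
    nontrivial-not A B ((p , pL , x) , (q , qL , y)) = (q , qL , f y) , (p , pL , g x)
      where
      f : A q ≡ false ⊎ B q ≡ false → not (A q) ≡ true ⊎ not (B q) ≡ true
      f (inj₁ e) = inj₁ (cong not e)
      f (inj₂ e) = inj₂ (cong not e)
      g : A p ≡ true ⊎ B p ≡ true → not (A p) ≡ false ⊎ not (B p) ≡ false
      g (inj₁ e) = inj₁ (cong not e)
      g (inj₂ e) = inj₂ (cong not e)

    nontrivial-swap : ∀ A B → Nontrivial A B → Nontrivial B A
    nontrivial-swap A B ((p , pL , x) , (q , qL , y)) = (p , pL , swap x) , (q , qL , swap y)

    -- Complementing S removes the hypothesis A 0 = true ...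
    shape-ordered : ∀ A B → switchesUpTo L B ≤ switchesUpTo L A → Nontrivial A B → HasCutShape A B
    shape-ordered A B le ne = go (A 0) refl
      where
      go : ∀ b → A 0 ≡ b → HasCutShape A B
      go true a0 = shape-normalised A B a0 le ne
      go false a0 = CutShape-cong (cutOf-not n N A B) (cong₂ _+_ (V-notnot A) (V-notnot B)) refl
        (CutShape-swap (shape-normalised (λ p → not (A p)) (λ p → not (B p)) (cong not a0)
          (subst₂ _≤_ (sym (switches-not N B)) (sym (switches-not N A)) le) (nontrivial-not A B ne)))

    -- ... and exchanging the rails the ordering of the switch counts.
    cutShape : ∀ A B → Nontrivial A B → HasCutShape A B
    cutShape A B ne with switchesUpTo L B ≤? switchesUpTo L A
    ... | yes le = shape-ordered A B le ne
    ... | no nle = CutShape-cong (cutOf-swap n N A B) (+-comm (V B) (V A)) (+-comm (V (λ p → not (B p))) (V (λ p → not (A p))))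
        (shape-ordered B A (<⇒≤ (≰⇒> nle)) (nontrivial-swap A B ne))


-- Upper bounds on v·w for v + w = 2M fixed: the further v is from M, the smaller v·w.
-- Here u is the pendant-path volume, X = M - u, and d the distance of the best prefix
-- volume from M; Qtail u X = u·(2X + u) and Qd e d = e·(M + d) with e = M - d are the
-- products realised by the pendant path and by the best prefix.
module ProductBounds where

  open import Data.Nat
  open import Data.Nat.Properties
  open import Data.Product using (_,_; Σ)
  open import Data.Sum using (_⊎_; inj₁; inj₂)
  open import Data.Empty
  open import Relation.Nullary
  open import Relation.Binary.PropositionalEquality
  open import Data.Nat.Tactic.RingSolver

  difference : ∀ {m n} → m ≤ n → Σ ℕ λ k → m + k ≡ n
  difference {m} {n} le = n ∸ m , m+[n∸m]≡n le

  product≤-unbalanced : ∀ v w t t' → v ≤ t → t ≤ t' → v + w ≡ t + t' → v * w ≤ t * t'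
  product≤-unbalanced v w t t' vt tt' e with difference vt | difference (≤-trans vt tt')
  ... | y , refl | z , refl = subst (v * w ≤_) (sym (id v y z)) (subst (λ q → v * q ≤ v * (y + v + z) + y * z) (sym weq) (m≤m+n _ _))
    where
    weq : w ≡ y + v + z
    weq = +-cancelˡ-≡ v w (y + v + z) (trans e (lem v y z))
      where
      lem : ∀ v y z → v + y + (v + z) ≡ v + (y + v + z)
      lem = solve-∀
    id : ∀ v y z → (v + y) * (v + z) ≡ v * (y + v + z) + y * z
    id = solve-∀

  product≤-unbalancedʳ : ∀ v w t t' → w ≤ t → t ≤ t' → v + w ≡ t + t' → v * w ≤ t * t'
  product≤-unbalancedʳ v w t t' wt tt' e = subst (_≤ t * t') (*-comm w v) (product≤-unbalanced w v t t' wt tt' (trans (+-comm w v) e))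

  product≤square : ∀ v w M → v + w ≡ M + M → v * w ≤ M * M
  product≤square v w M e with v ≤? M
  ... | yes p = product≤-unbalanced v w M M p ≤-refl e
  ... | no p = product≤-unbalancedʳ v w M M (+-cancelˡ-≤ M w M (subst (M + w ≤_) e (+-monoˡ-≤ w (<⇒≤ (≰⇒> p))))) ≤-refl e

  -- The product vol·volᶜ of the pendant path: u·(2X + u), since the total is 2M = 2(X + u).
  Qtail : ℕ → ℕ → ℕ
  Qtail u X = u * (X + X + u)

  -- The information about (cut, v, w) that the minimisation uses: cut ≥ 3, or cut = 1 and a
  -- side ≤ u, or cut = 2 and a side ≤ 2u or at distance ≥ d below M.
  ArithShape : ℕ → ℕ → ℕ → ℕ → ℕ → ℕ → Set
  ArithShape M u d c v w = 3 ≤ c ⊎ (c ≡ 1 × (v ≤ u ⊎ w ≤ u)) ⊎ (c ≡ 2 × ((v ≤ u + u ⊎ w ≤ u + u) ⊎ (v + d ≤ M ⊎ w + d ≤ M)))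

  Qtail+X² : ∀ M X u → M ≡ X + u → Qtail u X + X * X ≡ M * M
  Qtail+X² .(X + u) X u refl = lem X u
    where
    lem : ∀ X u → u * (X + X + u) + X * X ≡ (X + u) * (X + u)
    lem = solve-∀

  product≤Qtail : ∀ M X u v w → M ≡ X + u → v + w ≡ M + M → v ≤ u → v * w ≤ Qtail u X
  product≤Qtail M X u v w hM e vu = product≤-unbalanced v w u (X + X + u) vu (m≤n+m u (X + X)) (trans e (lem M X u hM))
    where
    lem : ∀ M X u → M ≡ X + u → M + M ≡ u + (X + X + u)
    lem .(X + u) X u refl = l2 X u
      where
      l2 : ∀ X u → X + u + (X + u) ≡ u + (X + X + u)
      l2 = solve-∀

  product≤Qtailʳ : ∀ M X u v w → M ≡ X + u → v + w ≡ M + M → w ≤ u → v * w ≤ Qtail u X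
  product≤Qtailʳ M X u v w hM e wu = subst (_≤ Qtail u X) (*-comm w v) (product≤Qtail M X u w v hM (trans (+-comm w v) e) wu)

  product≤Qd : ∀ M d e v w → M ≡ e + d → v + w ≡ M + M → v + d ≤ M → v * w ≤ e * (M + d)
  product≤Qd M d e v w hMe ew vd = product≤-unbalanced v w e (M + d) (+-cancelʳ-≤ d v e (subst (v + d ≤_) hMe vd))
    (≤-trans (m≤m+n e d) (subst (e + d ≤_) (sym (trans (cong (_+ d) hMe) refl)) (m≤m+n (e + d) d)))
    (trans ew (lem M d e hMe))
    where
    lem : ∀ M d e → M ≡ e + d → M + M ≡ e + (M + d)
    lem .(e + d) d e refl = l2 d e
      where
      l2 : ∀ d e → e + d + (e + d) ≡ e + (e + d + d)
      l2 = solve-∀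

  product≤Qdʳ : ∀ M d e v w → M ≡ e + d → v + w ≡ M + M → w + d ≤ M → v * w ≤ e * (M + d)
  product≤Qdʳ M d e v w hMe ew wd = subst (_≤ e * (M + d)) (*-comm w v) (product≤Qd M d e w v hMe (trans (+-comm w v) ew) wd)

  Qd+d² : ∀ M d e → M ≡ e + d → e * (M + d) + d * d ≡ M * M
  Qd+d² .(e + d) d e refl = lem d e
    where
    lem : ∀ d e → e * (e + d + d) + d * d ≡ (e + d) * (e + d)
    lem = solve-∀

  product≤2Qtail : ∀ M X u v w → M ≡ X + u → v + w ≡ M + M → v ≤ u + u → v * w ≤ 2 * Qtail u X
  product≤2Qtail M X u v w hM e vu with v ≤? u
  ... | yes p = ≤-trans (product≤Qtail M X u v w hM e p) (m≤m+n (Qtail u X) (Qtail u X + 0))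
  ... | no p = go (difference (<⇒≤ (≰⇒> p)))
    where
    go : (Σ ℕ λ y → u + y ≡ v) → v * w ≤ 2 * Qtail u X
    go (y , uy) = go2 (difference (+-cancelˡ-≤ u y u (subst (_≤ u + u) (sym uy) vu)))
      where
      go2 : (Σ ℕ λ z → y + z ≡ u) → v * w ≤ 2 * Qtail u X
      go2 (z , yz) = subst₂ _≤_ (cong₂ _*_ veq (sym weq)) (cong (λ q → 2 * Qtail q X) yz) (subst ((y + z + y) * (X + X + z) ≤_) (idt X y z) (m≤m+n _ _))
        where
        veq : y + z + y ≡ v
        veq = trans (cong (_+ y) yz) uy
        weq : w ≡ X + X + z
        weq = +-cancelˡ-≡ (y + z + y) w (X + X + z) (trans (cong (_+ w) veq) (trans e (trans (cong (λ q → q + q) hM) (trans (cong (λ q → X + q + (X + q)) (sym yz)) (l3 X y z)))))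
          where
          l3 : ∀ X y z → X + (y + z) + (X + (y + z)) ≡ y + z + y + (X + X + z)
          l3 = solve-∀
        idt : ∀ X y z → (y + z + y) * (X + X + z) + (2 * (y * y) + 2 * (y * z) + 2 * (X * z) + z * z) ≡ 2 * ((y + z) * (X + X + (y + z)))
        idt = solve-∀

  halve-≤ : ∀ a b → a + a ≤ b + b → a ≤ b
  halve-≤ a b h with a ≤? b
  ... | yes p = p
  ... | no p = ⊥-elim (<-irrefl refl (≤-trans (+-mono-< (≰⇒> p) (≰⇒> p)) h))

  2u≤X : ∀ M X u d → M ≡ X + u → M * M + d * d ≤ 2 * (X * X) → 1 ≤ X → u + u ≤ X
  2u≤X M X u d hM H1 X1 with u + u ≤? X
  ... | yes p = p
  ... | no p = ⊥-elim (<-irrefl refl (≤-trans c1 c2))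
    where
    q : suc X ≤ u + u
    q = ≰⇒> p
    c1 : suc (2 * (X * X)) ≤ X * X + X * (u + u) + u * u
    c1 = ≤-trans (≤-reflexive (l1 X)) (≤-trans (+-monoʳ-≤ (X * X + X * X) X1) (≤-trans (≤-reflexive (l1' X))
           (≤-trans (+-monoʳ-≤ (X * X) (*-monoʳ-≤ X q)) (m≤m+n _ _))))
      where
      l1 : ∀ X → suc (2 * (X * X)) ≡ X * X + X * X + 1
      l1 = solve-∀
      l1' : ∀ X → X * X + X * X + X ≡ X * X + X * suc X
      l1' = solve-∀
    c2 : X * X + X * (u + u) + u * u ≤ 2 * (X * X)
    c2 = ≤-trans (≤-reflexive (trans (l3 X u) (cong (λ z → z * z) (sym hM)))) (≤-trans (m≤m+n (M * M) (d * d)) H1)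
      where
      l3 : ∀ X u → X * X + X * (u + u) + u * u ≡ (X + u) * (X + u)
      l3 = solve-∀

  u+d≤X : ∀ M X u d → M ≡ X + u → M * M + d * d ≤ 2 * (X * X) → 2 * d ≤ X → 1 ≤ X → u + d ≤ X
  u+d≤X M X u d hM H1 H3 X1 = halve-≤ (u + d) X (subst (_≤ X + X) (l u d) (+-mono-≤ (2u≤X M X u d hM H1 X1) (subst (_≤ X) (l2 d) H3)))
    where
    l : ∀ u d → u + u + (d + d) ≡ u + d + (u + d)
    l = solve-∀
    l2 : ∀ d → 2 * d ≡ d + d
    l2 = solve-∀

  product≤Qtail-either : ∀ M X u v w → M ≡ X + u → v + w ≡ M + M → (v ≤ u ⊎ w ≤ u) → v * w ≤ Qtail u X
  product≤Qtail-either M X u v w hM ew (inj₁ x) = product≤Qtail M X u v w hM ew x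
  product≤Qtail-either M X u v w hM ew (inj₂ x) = product≤Qtailʳ M X u v w hM ew x

  product≤2Qtail-either : ∀ M X u v w → M ≡ X + u → v + w ≡ M + M → (v ≤ u + u ⊎ w ≤ u + u) → v * w ≤ 2 * Qtail u X
  product≤2Qtail-either M X u v w hM ew (inj₁ x) = product≤2Qtail M X u v w hM ew x
  product≤2Qtail-either M X u v w hM ew (inj₂ x) =
    subst (_≤ 2 * Qtail u X) (*-comm w v) (product≤2Qtail M X u w v hM (trans (+-comm w v) ew) x)

  product≤Qd-either : ∀ M d e v w → M ≡ e + d → v + w ≡ M + M → (v + d ≤ M ⊎ w + d ≤ M) → v * w ≤ e * (M + d)
  product≤Qd-either M d e v w hMe ew (inj₁ x) = product≤Qd M d e v w hMe ew x
  product≤Qd-either M d e v w hMe ew (inj₂ x) = product≤Qdʳ M d e v w hMe ew x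

  -- Comparisons of the candidate products.  In the prefix regime a cut of size 3 at best
  -- balance and the pendant path are both worse than the best prefix ...
  2M²≤3Qd : ∀ M d e → M ≡ e + d → 3 * (d * d) ≤ M * M → 2 * (M * M) ≤ 3 * (e * (M + d))
  2M²≤3Qd M d e hMe H2 = +-cancelʳ-≤ (3 * (d * d)) (2 * (M * M)) (3 * Q)
      (≤-trans (+-monoʳ-≤ (2 * (M * M)) H2)
        (≤-reflexive (trans (l (M * M)) (trans (cong (3 *_) (sym (Qd+d² M d e hMe))) (l3 Q (d * d))))))
    where
    Q = e * (M + d)
    l : ∀ a → 2 * a + a ≡ 3 * a
    l = solve-∀
    l3 : ∀ a b → 3 * (a + b) ≡ 3 * a + 3 * b
    l3 = solve-∀

  2Qtail≤Qd : ∀ M X u d e → M ≡ X + u → M ≡ e + d → M * M + d * d ≤ 2 * (X * X) → 2 * Qtail u X ≤ e * (M + d)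
  2Qtail≤Qd M X u d e hM hMe H1 = +-cancelʳ-≤ (d * d) (2 * Qtail u X) Q (subst (2 * Qtail u X + d * d ≤_) (sym (Qd+d² M d e hMe))
       (+-cancelʳ-≤ (2 * (X * X)) (2 * Qtail u X + d * d) (M * M)
         (≤-trans (≤-reflexive (trans (l (Qtail u X) (d * d) (X * X)) (cong (λ z → z + (z + d * d)) (Qtail+X² M X u hM))))
           (+-monoʳ-≤ (M * M) H1))))
    where
    Q = e * (M + d)
    l : ∀ a b c → 2 * a + b + 2 * c ≡ (a + c) + ((a + c) + b)
    l = solve-∀

  -- ... and in the pendant-path regime a cut of size 3 and the best prefix are worse than
  -- the pendant path.
  M²≤3Qtail : ∀ M X u d → M ≡ X + u → 2 * (X * X) ≤ M * M + d * d → 2 * (d * d) ≤ X * X → M * M ≤ 3 * Qtail u X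
  M²≤3Qtail M X u d hM H1 H2 = +-cancelʳ-≤ (3 * (X * X)) (M * M) (3 * Qtail u X)
      (≤-trans (+-monoʳ-≤ (M * M) 3X²≤2M²)
        (≤-reflexive (trans (l (M * M)) (trans (cong (3 *_) (sym (Qtail+X² M X u hM))) (l3 (Qtail u X) (X * X))))))
    where
    3X²≤2M² : 3 * (X * X) ≤ 2 * (M * M)
    3X²≤2M² = +-cancelʳ-≤ (X * X) (3 * (X * X)) (2 * (M * M))
      (≤-trans (≤-reflexive (l1 (X * X))) (≤-trans (*-monoʳ-≤ 2 H1)
        (≤-trans (≤-reflexive (l2 (M * M) (d * d))) (+-monoʳ-≤ (2 * (M * M)) H2))))
      where
      l1 : ∀ a → 3 * a + a ≡ 2 * (2 * a)
      l1 = solve-∀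
      l2 : ∀ a b → 2 * (a + b) ≡ 2 * a + 2 * b
      l2 = solve-∀
    l : ∀ a → a + 2 * a ≡ 3 * a
    l = solve-∀
    l3 : ∀ a b → 3 * (a + b) ≡ 3 * a + 3 * b
    l3 = solve-∀

  Qd≤2Qtail : ∀ M X u d e → M ≡ X + u → M ≡ e + d → 2 * (X * X) ≤ M * M + d * d → e * (M + d) ≤ 2 * Qtail u X
  Qd≤2Qtail M X u d e hM hMe H1 = +-cancelʳ-≤ (2 * (X * X) + d * d) Q (2 * Qtail u X)
      (≤-trans (≤-reflexive (trans (l1 Q (d * d) (X * X)) (cong (_+ 2 * (X * X)) (Qd+d² M d e hMe))))
        (≤-trans (+-monoʳ-≤ (M * M) H1)
          (≤-reflexive (trans (cong (λ z → z + (z + d * d)) (sym (Qtail+X² M X u hM))) (l2 (Qtail u X) (X * X) (d * d))))))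
    where
    Q = e * (M + d)
    l1 : ∀ a b c → a + (2 * c + b) ≡ (a + b) + 2 * c
    l1 = solve-∀
    l2 : ∀ a c b → (a + c) + ((a + c) + b) ≡ 2 * a + (2 * c + b)
    l2 = solve-∀

  -- When the prefix wins (M² + d² ≤ 2X²): cut·Qd ≥ 2·v·w for every admissible triple.
  cutBound-Qd : ∀ M X u d e → M ≡ X + u → M ≡ e + d → M * M + d * d ≤ 2 * (X * X) → 3 * (d * d) ≤ M * M → 2 * d ≤ X → 1 ≤ X →
    ∀ c v w → v + w ≡ M + M → ArithShape M u d c v w → 2 * (v * w) ≤ c * (e * (M + d))
  cutBound-Qd M X u d e hM hMe H1 H2 H3 X1 c v w ew = go
    where
    Q = e * (M + d)
    twoTails-deficit : ∀ x → x ≤ u + u → x + d ≤ M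
    twoTails-deficit x xu = ≤-trans (+-monoˡ-≤ d xu)
      (subst (u + u + d ≤_) (sym (trans hM (+-comm X u)))
        (subst (_≤ u + X) (sym (+-assoc u u d)) (+-monoʳ-≤ u (u+d≤X M X u d hM H1 H3 X1))))
    go : ArithShape M u d c v w → 2 * (v * w) ≤ c * Q
    go (inj₁ c3) = ≤-trans (*-monoʳ-≤ 2 (product≤square v w M ew)) (≤-trans (2M²≤3Qd M d e hMe H2) (*-monoˡ-≤ Q c3))
    go (inj₂ (inj₁ (refl , x))) = ≤-trans (*-monoʳ-≤ 2 (product≤Qtail-either M X u v w hM ew x))
      (subst (2 * Qtail u X ≤_) (sym (+-identityʳ Q)) (2Qtail≤Qd M X u d e hM hMe H1))
    go (inj₂ (inj₂ (refl , inj₁ (inj₁ x)))) = *-monoʳ-≤ 2 (product≤Qd-either M d e v w hMe ew (inj₁ (twoTails-deficit v x)))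
    go (inj₂ (inj₂ (refl , inj₁ (inj₂ x)))) = *-monoʳ-≤ 2 (product≤Qd-either M d e v w hMe ew (inj₂ (twoTails-deficit w x)))
    go (inj₂ (inj₂ (refl , inj₂ x))) = *-monoʳ-≤ 2 (product≤Qd-either M d e v w hMe ew x)

  -- When the pendant path wins (2X² ≤ M² + d²): cut·Qtail ≥ v·w for every admissible triple.
  cutBound-Qtail : ∀ M X u d e → M ≡ X + u → M ≡ e + d → 2 * (X * X) ≤ M * M + d * d → 2 * (d * d) ≤ X * X →
    ∀ c v w → v + w ≡ M + M → ArithShape M u d c v w → v * w ≤ c * Qtail u X
  cutBound-Qtail M X u d e hM hMe H1 H2 c v w ew = go
    where
    go : ArithShape M u d c v w → v * w ≤ c * Qtail u X
    go (inj₁ c3) = ≤-trans (product≤square v w M ew) (≤-trans (M²≤3Qtail M X u d hM H1 H2) (*-monoˡ-≤ (Qtail u X) c3))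
    go (inj₂ (inj₁ (refl , x))) = subst (v * w ≤_) (sym (+-identityʳ _)) (product≤Qtail-either M X u v w hM ew x)
    go (inj₂ (inj₂ (refl , inj₁ x))) = product≤2Qtail-either M X u v w hM ew x
    go (inj₂ (inj₂ (refl , inj₂ x))) = ≤-trans (product≤Qd-either M d e v w hMe ew x) (Qd≤2Qtail M X u d e hM hMe H1)


-- Ncut with cut c and volumes v, w compared with a fraction a/b, through cross
-- multiplication: a/b ≤ c(1/v + 1/w) ⇔ a·v·w ≤ c·(v + w)·b.
module RationalNcut where

  open import Defs
  open import Data.Nat as ℕ using (ℕ; suc; zero)
  import Data.Nat.Properties as ℕP
  open import Data.Integer as ℤ using (ℤ; +_)
  import Data.Integer.Properties as ℤP
  open import Data.Rational as ℚ using (ℚ; toℚᵘ; fromℚᵘ)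
  import Data.Rational.Properties as ℚP
  open import Data.Rational.Unnormalised as U using (ℚᵘ; mkℚᵘ; *≤*)
  import Data.Rational.Unnormalised.Properties as UP
  open import Relation.Binary.PropositionalEquality

  ncutOf : ℕ → ℕ → ℕ → ℚ
  ncutOf c v w = ((+ c) ℚ./ 1) ℚ.* (recip v ℚ.+ recip w)

  qy : ℕ → ℕ → ℕ → ℚᵘ
  qy c v w = mkℚᵘ (+ c) 0 U.* (mkℚᵘ (+ 1) v U.+ mkℚᵘ (+ 1) w)

  eqY : ∀ c v w → toℚᵘ (ncutOf c (suc v) (suc w)) U.≃ qy c v w
  eqY c v w = UP.≃-trans (ℚP.toℚᵘ-homo-* ((+ c) ℚ./ 1) (recip (suc v) ℚ.+ recip (suc w)))
    (UP.*-cong (ℚP.toℚᵘ-fromℚᵘ (mkℚᵘ (+ c) 0))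
      (UP.≃-trans (ℚP.toℚᵘ-homo-+ (recip (suc v)) (recip (suc w)))
        (UP.+-cong (ℚP.toℚᵘ-fromℚᵘ (mkℚᵘ (+ 1) v)) (ℚP.toℚᵘ-fromℚᵘ (mkℚᵘ (+ 1) w)))))

  eqA : ∀ a b → toℚᵘ (frac a (suc b)) U.≃ mkℚᵘ (+ a) b
  eqA a b = ℚP.toℚᵘ-fromℚᵘ (mkℚᵘ (+ a) b)

  upY : ∀ c v w → U.↥ (qy c v w) ≡ + (c ℕ.* (suc w ℕ.+ suc v))
  upY c v w = trans (cong ((+ c) ℤ.*_) (trans (cong₂ ℤ._+_ (ℤP.*-identityˡ (+ suc w)) (ℤP.*-identityˡ (+ suc v))) (sym (ℤP.pos-+ (suc w) (suc v)))))
    (sym (ℤP.pos-* c (suc w ℕ.+ suc v)))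

  core≤ : ∀ a b c v w → a ℕ.* (suc v ℕ.* suc w) ℕ.≤ c ℕ.* (suc v ℕ.+ suc w) ℕ.* suc b →
    mkℚᵘ (+ a) b U.≤ qy c v w
  core≤ a b c v w h = *≤* (subst₂ ℤ._≤_ e1 e2 (ℤ.+≤+ h'))
    where
    e1 : + (a ℕ.* (1 ℕ.* (suc v ℕ.* suc w))) ≡ (+ a) ℤ.* U.↧ (qy c v w)
    e1 = ℤP.pos-* a _
    e2 : + (c ℕ.* (suc w ℕ.+ suc v) ℕ.* suc b) ≡ U.↥ (qy c v w) ℤ.* (+ suc b)
    e2 = trans (ℤP.pos-* (c ℕ.* (suc w ℕ.+ suc v)) (suc b)) (cong (ℤ._* (+ suc b)) (sym (upY c v w)))
    h' : a ℕ.* (1 ℕ.* (suc v ℕ.* suc w)) ℕ.≤ c ℕ.* (suc w ℕ.+ suc v) ℕ.* suc b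
    h' = subst₂ ℕ._≤_ (cong (a ℕ.*_) (sym (ℕP.*-identityˡ _))) (cong (λ z → c ℕ.* z ℕ.* suc b) (ℕP.+-comm (suc v) (suc w))) h

  core≥ : ∀ a b c v w → c ℕ.* (suc v ℕ.+ suc w) ℕ.* suc b ℕ.≤ a ℕ.* (suc v ℕ.* suc w) →
    qy c v w U.≤ mkℚᵘ (+ a) b
  core≥ a b c v w h = *≤* (subst₂ ℤ._≤_ e2 e1 (ℤ.+≤+ h'))
    where
    e1 : + (a ℕ.* (1 ℕ.* (suc v ℕ.* suc w))) ≡ (+ a) ℤ.* U.↧ (qy c v w)
    e1 = ℤP.pos-* a _
    e2 : + (c ℕ.* (suc w ℕ.+ suc v) ℕ.* suc b) ≡ U.↥ (qy c v w) ℤ.* (+ suc b)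
    e2 = trans (ℤP.pos-* (c ℕ.* (suc w ℕ.+ suc v)) (suc b)) (cong (ℤ._* (+ suc b)) (sym (upY c v w)))
    h' : c ℕ.* (suc w ℕ.+ suc v) ℕ.* suc b ℕ.≤ a ℕ.* (1 ℕ.* (suc v ℕ.* suc w))
    h' = subst₂ ℕ._≤_ (cong (λ z → c ℕ.* z ℕ.* suc b) (ℕP.+-comm (suc v) (suc w))) (cong (a ℕ.*_) (sym (ℕP.*-identityˡ _))) h

  frac≤ncut : ∀ a b c v w → a ℕ.* (suc v ℕ.* suc w) ℕ.≤ c ℕ.* (suc v ℕ.+ suc w) ℕ.* suc b →
    frac a (suc b) ℚ.≤ ncutOf c (suc v) (suc w)
  frac≤ncut a b c v w h = ℚP.toℚᵘ-cancel-≤ (UP.≤-respˡ-≃ (UP.≃-sym (eqA a b)) (UP.≤-respʳ-≃ (UP.≃-sym (eqY c v w)) (core≤ a b c v w h)))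

  ncut≤frac : ∀ a b c v w → c ℕ.* (suc v ℕ.+ suc w) ℕ.* suc b ℕ.≤ a ℕ.* (suc v ℕ.* suc w) →
    ncutOf c (suc v) (suc w) ℚ.≤ frac a (suc b)
  ncut≤frac a b c v w h = ℚP.toℚᵘ-cancel-≤ (UP.≤-respʳ-≃ (UP.≃-sym (eqA a b)) (UP.≤-respˡ-≃ (UP.≃-sym (eqY c v w)) (core≥ a b c v w h)))

  ncut≡frac : ∀ a b c v w → a ℕ.* (suc v ℕ.* suc w) ≡ c ℕ.* (suc v ℕ.+ suc w) ℕ.* suc b →
    ncutOf c (suc v) (suc w) ≡ frac a (suc b)
  ncut≡frac a b c v w e = ℚP.≤-antisym (ncut≤frac a b c v w (ℕP.≤-reflexive (sym e))) (frac≤ncut a b c v w (ℕP.≤-reflexive e))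

  frac≤ncut⁺ : ∀ a Bd c v w → 1 ℕ.≤ v → 1 ℕ.≤ w → 1 ℕ.≤ Bd →
    a ℕ.* (v ℕ.* w) ℕ.≤ c ℕ.* (v ℕ.+ w) ℕ.* Bd → frac a Bd ℚ.≤ ncutOf c v w
  frac≤ncut⁺ a (suc b) c (suc v) (suc w) _ _ _ h = frac≤ncut a b c v w h

  ncut≡frac⁺ : ∀ a Bd c v w → 1 ℕ.≤ v → 1 ℕ.≤ w → 1 ℕ.≤ Bd →
    a ℕ.* (v ℕ.* w) ≡ c ℕ.* (v ℕ.+ w) ℕ.* Bd → ncutOf c v w ≡ frac a Bd
  ncut≡frac⁺ a (suc b) c (suc v) (suc w) _ _ _ h = ncut≡frac a b c v w h

-- The explicit volumes of R_{n,k}, k = k' + 2: D j = 2j - 1 on the pendant path,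
-- D j = 3j - n - 1 beyond it, M = D (n + k) = vol of one rail = X + u with X = 3k - 1,
-- u = 2n - 1; and the translation of CutShape into ArithShape.
module LadderVolumes where

  open FiniteSums
  open VertexSums using (degAt; lt-true; le-true; le-false)
  open CutClassification
  open ProductBounds
  open import Data.Nat
  open import Data.Nat.Properties
  open import Data.Product using (_×_; _,_; Σ)
  open import Data.Sum using (_⊎_; inj₁; inj₂)
  open import Data.Empty
  open import Relation.Nullary
  open import Relation.Binary.PropositionalEquality
  open import Data.Nat.Tactic.RingSolver

  module Volumes (n k' : ℕ) (n1 : 1 ≤ n) where
    L : ℕ
    L = n + suc k'

    nL : n < L
    nL = m<m+n n (s≤s z≤n)

    k : ℕ
    k = suc (suc k')

    open Shapes n L n1 nL public

    degAt-inner : ∀ q → 1 ≤ q → q < L → degAt n N q ≡ 2 + bit (n ≤ᵇ q)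
    degAt-inner q q1 qL rewrite lt-true q L qL | prv1 q q1 = refl

    degAt-path : ∀ q → 1 ≤ q → q < n → degAt n N q ≡ 2
    degAt-path q q1 qn rewrite degAt-inner q q1 (<-trans qn nL) | le-false n q qn = refl

    degAt-ladder : ∀ q → n ≤ q → q < L → degAt n N q ≡ 3
    degAt-ladder q nq qL rewrite degAt-inner q (≤-trans n1 nq) qL | le-true n q nq = refl

    degAt-first : degAt n N 0 ≡ 1
    degAt-first rewrite lt-true 0 L (≤-trans n1 (<⇒≤ nL)) | le-false n 0 n1 = refl

    D-path : ∀ j → 1 ≤ j → j ≤ n → D j + 1 ≡ j + j
    D-path (suc zero) _ _ = cong (λ z → z + 0 + 1) degAt-first
    D-path (suc (suc j)) _ jn =
      trans (cong (_+ 1) (sumTo-snoc (suc j) (degAt n N)))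
      (trans (cong (λ z → D (suc j) + z + 1) (degAt-path (suc j) (s≤s z≤n) jn))
      (trans (l1 (D (suc j))) (trans (cong (_+ 2) (D-path (suc j) (s≤s z≤n) (<⇒≤ jn))) (l2 j))))
      where
      l1 : ∀ a → a + 2 + 1 ≡ a + 1 + 2
      l1 = solve-∀
      l2 : ∀ j → suc j + suc j + 2 ≡ suc (suc j) + suc (suc j)
      l2 = solve-∀

    D-ladder : ∀ j → n ≤ j → j ≤ L → D j + n + 1 ≡ 3 * j
    D-ladder zero nj _ = ⊥-elim (<-irrefl refl (≤-trans n1 nj))
    D-ladder (suc j) nj jL with n ≟ suc j
    ... | yes refl = trans (l (D (suc j)) j) (trans (cong (_+ suc j) (D-path (suc j) n1 ≤-refl)) (l2 j))
      where
      l : ∀ a j → a + suc j + 1 ≡ a + 1 + suc j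
      l = solve-∀
      l2 : ∀ j → suc j + suc j + suc j ≡ 3 * suc j
      l2 = solve-∀
    ... | no ne = trans (cong (λ z → z + n + 1) (trans (sumTo-snoc j (degAt n N)) (cong (D j +_) (degAt-ladder j nj' jL))))
        (trans (l (D j) n) (trans (cong (_+ 3) (D-ladder j nj' (<⇒≤ jL))) (l2 j)))
      where
      nj' : n ≤ j
      nj' = ≤-pred (≤∧≢⇒< nj ne)
      l : ∀ a n → a + 3 + n + 1 ≡ a + n + 1 + 3
      l = solve-∀
      l2 : ∀ j → 3 * j + 3 ≡ 3 * suc j
      l2 = solve-∀

    M : ℕ
    M = D N

    X : ℕ
    X = 3 * k' + 5

    M-last : M ≡ D L + 2
    M-last = trans (sumTo-snoc L (degAt n N)) (cong (D L +_) degAt-last)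

    u2 : u + 1 ≡ n + n
    u2 = D-path n n1 ≤-refl

    M2 : M + n + 1 ≡ 3 * L + 2
    M2 = trans (cong (λ z → z + n + 1) M-last) (trans (l (D L) n) (cong (_+ 2) (D-ladder L (<⇒≤ nL) ≤-refl)))
      where
      l : ∀ a n → a + 2 + n + 1 ≡ a + n + 1 + 2
      l = solve-∀

    hM : M ≡ X + u
    hM = +-cancelʳ-≡ (n + 1) M (X + u) (trans (sym (+-assoc M n 1)) (trans M2 (trans (l n k') (sym (trans (l3 X u n) (cong (λ z → X + z + n) u2))))))
      where
      l : ∀ n k' → 3 * (n + suc k') + 2 ≡ 3 * k' + 5 + (n + n) + n
      l = solve-∀
      l3 : ∀ X u n → X + u + (n + 1) ≡ X + (u + 1) + n
      l3 = solve-∀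

    -- No prefix volume 2 D j = 6j - 2n - 2 lies strictly within distance d of M
    -- (written with Z = 4n + 3k = M + 2n + 2).
    FarFrom : ℕ → Set
    FarFrom d = ∀ j → 6 * j + d ≤ 4 * n + 3 * k ⊎ 4 * n + 3 * k + d ≤ 6 * j

    Z2 : 4 * n + 3 * k ≡ M + (2 * n + 2)
    Z2 = +-cancelʳ-≡ (n + 1) _ _ (trans (l n k') (sym (trans (l2 M n) (cong (λ z → z + (n + n) + 2) M2))))
      where
      l : ∀ n k' → 4 * n + 3 * suc (suc k') + (n + 1) ≡ 3 * (n + suc k') + 2 + (n + n) + 2
      l = solve-∀
      l2 : ∀ M n → M + (2 * n + 2) + (n + 1) ≡ M + n + 1 + (n + n) + 2
      l2 = solve-∀

    ladderVol6 : ∀ j → n ≤ j → j ≤ L → D j + D j + (2 * n + 2) ≡ 6 * j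
    ladderVol6 j nj jL = trans (l (D j) n) (trans (cong (λ z → z + z) (D-ladder j nj jL)) (l2 j))
      where
      l : ∀ a n → a + a + (2 * n + 2) ≡ (a + n + 1) + (a + n + 1)
      l = solve-∀
      l2 : ∀ j → 3 * j + 3 * j ≡ 6 * j
      l2 = solve-∀

    D-afterPath : D (suc n) ≡ u + 3
    D-afterPath = trans (sumTo-snoc n (degAt n N)) (cong (u +_) (degAt-ladder n ≤-refl nL))

    twoCutSide-arith : ∀ d → d + 3 ≤ X → FarFrom d → (L ≡ suc n → d ≡ 0) → ∀ x y → x + y ≡ M + M → TwoCutSide x →
      (x ≤ u + u) ⊎ (x + d ≤ M ⊎ y + d ≤ M)
    twoCutSide-arith d dX R k2 x y exy (inj₁ t) = inj₁ t
    twoCutSide-arith d dX R k2 x y exy (inj₂ (inj₁ e)) = inj₂ (inj₁ (subst (_≤ M) (sym (trans (cong (_+ d) (trans e D-afterPath)) (l u d)))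
        (subst (u + (d + 3) ≤_) (trans (+-comm u X) (sym hM)) (+-monoʳ-≤ u dX))))
      where
      l : ∀ u d → u + 3 + d ≡ u + (d + 3)
      l = solve-∀
    twoCutSide-arith d dX R k2 x y exy (inj₂ (inj₂ (inj₁ (j , nj , jL , e)))) with R j
    ... | inj₁ h = inj₂ (inj₁ (+-cancelʳ-≤ (2 * n + 2) (x + d) M (subst₂ _≤_ (sym a1) Z2 h)))
      where
      a1 : x + d + (2 * n + 2) ≡ 6 * j + d
      a1 = trans (l x d (2 * n + 2)) (cong (_+ d) (trans (cong (_+ (2 * n + 2)) e) (ladderVol6 j nj jL)))
        where
        l : ∀ x d c → x + d + c ≡ x + c + d
        l = solve-∀
    ... | inj₂ h = inj₂ (inj₂ (+-cancelʳ-≤ M (y + d) M (subst₂ _≤_ (l y d M) exy' (+-monoʳ-≤ y Md))))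
      where
      Md : M + d ≤ x
      Md = +-cancelʳ-≤ (2 * n + 2) (M + d) x (subst₂ _≤_ (trans (cong (_+ d) Z2) (l2 M d (2 * n + 2))) (sym (trans (cong (_+ (2 * n + 2)) e) (ladderVol6 j nj jL))) h)
        where
        l2 : ∀ M d c → M + c + d ≡ M + d + c
        l2 = solve-∀
      exy' : y + x ≡ M + M
      exy' = trans (+-comm y x) exy
      l : ∀ y d M → y + (M + d) ≡ y + d + M
      l = solve-∀
    twoCutSide-arith d dX R k2 x y exy (inj₂ (inj₂ (inj₂ (Leq , e)))) = inj₂ (inj₁ (subst (λ z → x + z ≤ M) (sym (k2 Leq)) (≤-reflexive (trans (+-identityʳ x) e))))

    cutShape-arith : ∀ d → d + 3 ≤ X → FarFrom d → (L ≡ suc n → d ≡ 0) → ∀ c v w → v + w ≡ M + M → CutShape c v w → ArithShape M u d c v w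
    cutShape-arith d dX R k2 c v w evw (inj₁ x) = inj₁ x
    cutShape-arith d dX R k2 c v w evw (inj₂ (inj₁ x)) = inj₂ (inj₁ x)
    cutShape-arith d dX R k2 c v w evw (inj₂ (inj₂ (e , inj₁ g))) = inj₂ (inj₂ (e , f (twoCutSide-arith d dX R k2 v w evw g)))
      where
      f : (v ≤ u + u) ⊎ (v + d ≤ M ⊎ w + d ≤ M) → (v ≤ u + u ⊎ w ≤ u + u) ⊎ (v + d ≤ M ⊎ w + d ≤ M)
      f (inj₁ a) = inj₁ (inj₁ a)
      f (inj₂ a) = inj₂ a
    cutShape-arith d dX R k2 c v w evw (inj₂ (inj₂ (e , inj₂ g))) = inj₂ (inj₂ (e , f (twoCutSide-arith d dX R k2 w v (trans (+-comm w v) evw) g)))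
      where
      f : (w ≤ u + u) ⊎ (w + d ≤ M ⊎ v + d ≤ M) → (v ≤ u + u ⊎ w ≤ u + u) ⊎ (v + d ≤ M ⊎ w + d ≤ M)
      f (inj₁ a) = inj₁ (inj₂ a)
      f (inj₂ (inj₁ a)) = inj₂ (inj₂ a)
      f (inj₂ (inj₂ a)) = inj₂ (inj₁ a)


module LadderSubsets where

  open import Defs
  open FiniteSums
  open VertexSums using (degAt; lt-true; lt-false; atIndex-toℕ; atIndex-tab)
  open import Data.Fin.Properties using (toℕ-fromℕ<; toℕ<n)
  open CutEncoding using (volOf; switches; cutOf; module Encode)
  open BooleanRuns
  open CutClassification
  open ProductBounds
  open LadderVolumes
  open import Data.Nat
  open import Data.Nat.Properties
  open import Data.Bool using (Bool; true; false; not; _∧_; _∨_; _xor_; if_then_else_)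
  open import Data.Fin using (Fin; toℕ; fromℕ<)
  open import Data.Product using (_×_; _,_; Σ; proj₁; proj₂)
  open import Data.Sum using (_⊎_; inj₁; inj₂)
  open import Relation.Binary.PropositionalEquality
  open import Data.Nat.Tactic.RingSolver

  module Subsets (n k' : ℕ) (n1 : 1 ≤ n) where
    open Volumes n k' n1 public

    eqN : n + k ≡ N
    eqN = +-suc n (suc k')

    vol-pos : ∀ A p → p ≤ L → A p ≡ true → 1 ≤ V A
    vol-pos A p pL e = ≤-trans (dg≥1 p pL) (≤-trans (≤-reflexive (sym (cong (λ z → if z then degAt n N p else 0) e))) (term≤sumTo N (λ q → if A q then degAt n N q else 0) p (s≤s pL)))
      where
      dg≥1 : ∀ p → p ≤ L → 1 ≤ degAt n N p
      dg≥1 zero _ = ≤-trans (≤-reflexive (sym degAt-first)) ≤-refl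
      dg≥1 (suc p) _ = ≤-trans (s≤s z≤n) (≤-trans (m≤n+m 1 (if suc (suc p) <ᵇ N then 1 else 0)) (m≤m+n _ _))

    vol-complementary : ∀ A → V A + V (λ p → not (A p)) ≡ M
    vol-complementary A = trans (sym (sumTo-+ N (λ p → if A p then degAt n N p else 0) (λ p → if not (A p) then degAt n N p else 0)))
                   (sumTo-cong N (λ p _ → f (A p) (degAt n N p)))
      where
      f : ∀ b d → (if b then d else 0) + (if not b then d else 0) ≡ d
      f true d = +-identityʳ d
      f false d = refl

    module OfSet (S : VSet n k) where
      open Encode n k S public using (A; B; vol-encode; volᶜ-encode; cut-encode)

      vol-rails : vol n k S ≡ V A + V B
      vol-rails = trans vol-encode (cong (λ Q → volOf n Q A + volOf n Q B) eqN)

      volᶜ-rails : vol n k (complement n k S) ≡ V (λ p → not (A p)) + V (λ p → not (B p))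
      volᶜ-rails = trans volᶜ-encode (cong (λ Q → volOf n Q (λ p → not (A p)) + volOf n Q (λ p → not (B p))) eqN)

      cut-rails : cutC n k S ≡ cutOf n N A B
      cut-rails = trans cut-encode (cong (λ Q → cutOf n Q A B) eqN)

      vol-total : vol n k S + vol n k (complement n k S) ≡ M + M
      vol-total = trans (cong₂ _+_ vol-rails volᶜ-rails) (trans (l (V A) (V B) _ _) (cong₂ _+_ (vol-complementary A) (vol-complementary B)))
        where
        l : ∀ a b c d → a + b + (c + d) ≡ a + c + (b + d)
        l = solve-∀

      jL : ∀ (j : Fin (n + k)) → toℕ j ≤ L
      jL j = ≤-pred (subst (toℕ j <_) eqN (toℕ<n j))

      atA : ∀ j → A (toℕ j) ≡ S (false , j)
      atA j = atIndex-toℕ (n + k) false (λ i → S (false , i)) j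

      atB : ∀ j → B (toℕ j) ≡ S (true , j)
      atB j = atIndex-toℕ (n + k) false (λ i → S (true , i)) j

      outside : ∀ r j → S (r , j) ≡ false → Σ ℕ λ p → p ≤ L × (A p ≡ false ⊎ B p ≡ false)
      outside false j e = toℕ j , jL j , inj₁ (trans (atA j) e)
      outside true j e = toℕ j , jL j , inj₂ (trans (atB j) e)

      nontrivial-rails : NonemptyProper n k S → Nontrivial A B
      nontrivial-rails (((false , j) , e1) , ((r , i) , e2)) = (toℕ j , jL j , inj₁ (trans (atA j) e1)) , outside r i e2
      nontrivial-rails (((true , j) , e1) , ((r , i) , e2)) = (toℕ j , jL j , inj₂ (trans (atB j) e1)) , outside r i e2

      vol-positive : NonemptyProper n k S → 1 ≤ vol n k S
      vol-positive ne with proj₁ (nontrivial-rails ne)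
      ... | p , pL , inj₁ e = subst (1 ≤_) (sym vol-rails) (≤-trans (vol-pos A p pL e) (m≤m+n (V A) (V B)))
      ... | p , pL , inj₂ e = subst (1 ≤_) (sym vol-rails) (≤-trans (vol-pos B p pL e) (m≤n+m (V B) (V A)))

      volᶜ-positive : NonemptyProper n k S → 1 ≤ vol n k (complement n k S)
      volᶜ-positive ne with proj₂ (nontrivial-rails ne)
      ... | p , pL , inj₁ e = subst (1 ≤_) (sym volᶜ-rails) (≤-trans (vol-pos (λ q → not (A q)) p pL (cong not e)) (m≤m+n (V (λ q → not (A q))) (V (λ q → not (B q)))))
      ... | p , pL , inj₂ e = subst (1 ≤_) (sym volᶜ-rails) (≤-trans (vol-pos (λ q → not (B q)) p pL (cong not e)) (m≤n+m (V (λ q → not (B q))) (V (λ q → not (A q)))))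

      cutShape-of : NonemptyProper n k S → CutShape (cutC n k S) (vol n k S) (vol n k (complement n k S))
      cutShape-of ne = CutShape-cong (sym cut-rails) (sym vol-rails) (sym volᶜ-rails) (cutShape A B (nontrivial-rails ne))

    cutOf-cong : ∀ A B A' B' → (∀ p → p ≤ L → A p ≡ A' p) → (∀ p → p ≤ L → B p ≡ B' p) → cutOf n N A B ≡ cutOf n N A' B'
    cutOf-cong A B A' B' ha hb = cong₂ _+_ (cong₂ _+_ (cg A A' ha) (cg B B' hb))
      (sumTo-cong N (λ p lt → cong (λ z → if n ≤ᵇ p then bit z else 0) (cong₂ _xor_ (ha p (≤-pred lt)) (hb p (≤-pred lt)))))
      where
      cg : ∀ A A' → (∀ p → p ≤ L → A p ≡ A' p) → switches N A ≡ switches N A'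
      cg A A' h = sumTo-cong L (λ p lt → cong bit (cong₂ _xor_ (h p (<⇒≤ lt)) (h (suc p) lt)))

    switches-step : ∀ L' j → 1 ≤ j → j ≤ L' → switchesUpTo L' (λ p → p <ᵇ j) ≡ 1
    switches-step (suc L') (suc zero) _ _ = cong suc (sumTo-zeros L')
    switches-step (suc L') (suc (suc j)) _ (s≤s jL) = switches-step L' (suc j) (s≤s z≤n) jL

    switches-const : ∀ L' → switchesUpTo L' (λ _ → false) ≡ 0
    switches-const L' = sumTo-zeros L'

    fin : ∀ m → m ≤ L → Fin (n + k)
    fin m mL = fromℕ< (subst (m <_) (sym eqN) (s≤s mL))

    finv : ∀ m mL → toℕ (fin m mL) ≡ m
    finv m mL = toℕ-fromℕ< (subst (m <_) (sym eqN) (s≤s mL))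

    prefixSet : ℕ → VSet n k
    prefixSet j (r , i) = toℕ i <ᵇ j

    module PrefixCut (j : ℕ) (nj : n ≤ j) (jL' : j ≤ L) where
      open OfSet (prefixSet j)
      pA : ∀ p → p ≤ L → A p ≡ (p <ᵇ j)
      pA p pL = atIndex-tab (n + k) false (λ q → q <ᵇ j) p (subst (p <_) (sym eqN) (s≤s pL))
      pB : ∀ p → p ≤ L → B p ≡ (p <ᵇ j)
      pB p pL = atIndex-tab (n + k) false (λ q → q <ᵇ j) p (subst (p <_) (sym eqN) (s≤s pL))
      j1 : 1 ≤ j
      j1 = ≤-trans n1 nj
      ne : NonemptyProper n k (prefixSet j)
      ne = ((false , fin 0 z≤n) , trans (cong (_<ᵇ j) (finv 0 z≤n)) (lt-true 0 j j1))
         , ((false , fin L ≤-refl) , trans (cong (_<ᵇ j) (finv L ≤-refl)) (lt-false L j jL'))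
      cut-prefix : cutC n k (prefixSet j) ≡ 2
      cut-prefix = trans cut-rails (trans (cutOf-cong A B (λ p → p <ᵇ j) (λ p → p <ᵇ j) pA pB)
        (cong₂ _+_ (cong₂ _+_ (switches-step L j j1 jL') (switches-step L j j1 jL'))
           (rungMismatch-none (λ p → p <ᵇ j) (λ p → p <ᵇ j) (λ p _ _ → xor-same (p <ᵇ j)))))
      vol-prefixSet : vol n k (prefixSet j) ≡ D j + D j
      vol-prefixSet = trans vol-rails (cong₂ _+_ (vol-prefix A j (≤-trans jL' (n≤1+n L)) pA) (vol-prefix B j (≤-trans jL' (n≤1+n L)) pB))

    tailSet : VSet n k
    tailSet (r , i) = not r ∧ (toℕ i <ᵇ n)

    module TailCut where
      open OfSet tailSet
      pA : ∀ p → p ≤ L → A p ≡ (p <ᵇ n)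
      pA p pL = atIndex-tab (n + k) false (λ q → q <ᵇ n) p (subst (p <_) (sym eqN) (s≤s pL))
      pB : ∀ p → p ≤ L → B p ≡ false
      pB p pL = atIndex-tab (n + k) false (λ q → false) p (subst (p <_) (sym eqN) (s≤s pL))
      ne : NonemptyProper n k tailSet
      ne = ((false , fin 0 z≤n) , trans (cong (_<ᵇ n) (finv 0 z≤n)) (lt-true 0 n n1))
         , ((true , fin 0 z≤n) , refl)
      cut-tail : cutC n k tailSet ≡ 1
      cut-tail = trans cut-rails (trans (cutOf-cong A B (λ p → p <ᵇ n) (λ _ → false) pA pB)
        (cong₂ _+_ (cong₂ _+_ (switches-step L n n1 (<⇒≤ nL)) (switches-const L))
           (rungMismatch-none (λ p → p <ᵇ n) (λ _ → false) (λ p np _ → cong (_xor false) (lt-false p n np)))))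
      vol-tailSet : vol n k tailSet ≡ u
      vol-tailSet = trans vol-rails (trans (cong₂ _+_ (vol-prefix A n (≤-trans (<⇒≤ nL) (n≤1+n L)) pA) (vol-empty B pB)) (+-identityʳ u))


module MinimalityCriteria where

  open import Defs
  open FiniteSums
  open CutClassification
  open ProductBounds
  open RationalNcut
  open LadderVolumes
  open LadderSubsets
  open import Data.Nat
  open import Data.Nat.Properties
  open import Data.Product using (_×_; _,_; Σ; ∃)
  open import Data.Sum using (_⊎_; inj₁; inj₂)
  open import Relation.Binary.PropositionalEquality
  open import Data.Nat.Tactic.RingSolver
  import Data.Rational as ℚ

  module Criteria (n k' : ℕ) (n1 : 1 ≤ n) where
    open Subsets n k' n1

    -- 6j + d = Z or 6j = Z + d says that the prefix of length j has volume M ∓ d.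
    Z : ℕ
    Z = 4 * n + 3 * k

    prefix-product : ∀ d e j (nj : n ≤ j) (jL : j ≤ L) → M ≡ e + d → (6 * j + d ≡ Z ⊎ 6 * j ≡ Z + d) →
      (D j + D j) * vol n k (complement n k (prefixSet j)) ≡ e * (M + d)
    prefix-product d e j nj jL hMe (inj₁ e1) = cong₂ _*_ ve we
      where
      open PrefixCut j nj jL
      open OfSet (prefixSet j) using () renaming (vol-total to vol-total-prefix)
      w = vol n k (complement n k (prefixSet j))
      vd : D j + D j + d ≡ M
      vd = +-cancelʳ-≡ (2 * n + 2) _ _ (trans (l (D j + D j) d (2 * n + 2)) (trans (cong (_+ d) (ladderVol6 j nj jL)) (trans e1 Z2)))
        where
        l : ∀ a b c → a + b + c ≡ a + c + b
        l = solve-∀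
      ve : D j + D j ≡ e
      ve = +-cancelʳ-≡ d _ _ (trans vd hMe)
      we : w ≡ M + d
      we = +-cancelˡ-≡ (D j + D j) _ _ (trans (trans (cong (_+ w) (sym vol-prefixSet)) vol-total-prefix) (trans (cong (_+ M) (sym vd)) (l (D j + D j) d M)))
        where
        l : ∀ a b c → a + b + c ≡ a + (c + b)
        l = solve-∀
    prefix-product d e j nj jL hMe (inj₂ e2) = trans (*-comm (D j + D j) w) (cong₂ _*_ we vd)
      where
      open PrefixCut j nj jL
      open OfSet (prefixSet j) using () renaming (vol-total to vol-total-prefix)
      w = vol n k (complement n k (prefixSet j))
      vd : D j + D j ≡ M + d
      vd = +-cancelʳ-≡ (2 * n + 2) _ _ (trans (ladderVol6 j nj jL) (trans e2 (trans (cong (_+ d) Z2) (l M (2 * n + 2) d))))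
        where
        l : ∀ a b c → a + b + c ≡ a + c + b
        l = solve-∀
      wd : w + d ≡ M
      wd = trans (+-comm w d) (+-cancelˡ-≡ M _ _ (trans (sym (+-assoc M d w)) (trans (cong (_+ w) (sym vd)) (trans (cong (_+ w) (sym vol-prefixSet)) vol-total-prefix))))
      we : w ≡ e
      we = +-cancelʳ-≡ d _ _ (trans wd hMe)

    -- If the prefix regime holds with deficit d and a/Bd = 2·2M / Qd (hyA, hyW express this
    -- scaled), and a prefix of volume M ∓ d exists, then Mcut = a/Bd.
    mcut-viaPrefix : ∀ d e a Bd → 1 ≤ Bd → M ≡ e + d → M * M + d * d ≤ 2 * (X * X) → 3 * (d * d) ≤ M * M → 2 * d ≤ X → 1 ≤ X →
      d + 3 ≤ X → FarFrom d → (L ≡ suc n → d ≡ 0) →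
      (∀ P c → 2 * P ≤ c * (e * (M + d)) → a * P ≤ c * (M + M) * Bd) →
      a * (e * (M + d)) ≡ 2 * (M + M) * Bd →
      (Σ ℕ λ j → n ≤ j × j ≤ L × (6 * j + d ≡ Z ⊎ 6 * j ≡ Z + d)) →
      IsMcut n k (frac a Bd)
    mcut-viaPrefix d e a Bd B1 hMe H1 H2 H3 X1 dX R k2 hyA hyW (j , nj , jL , ej) = wit , low
      where
      low : (S : VSet n k) → NonemptyProper n k S → frac a Bd ℚ.≤ Ncut n k S
      low S ne = frac≤ncut⁺ a Bd (cutC n k S) (vol n k S) (vol n k (complement n k S)) (vol-positive ne) (volᶜ-positive ne) B1
        (subst (λ z → a * (vol n k S * vol n k (complement n k S)) ≤ cutC n k S * z * Bd) (sym vol-total)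
          (hyA _ (cutC n k S) (cutBound-Qd M X u d e hM hMe H1 H2 H3 X1 _ _ _ vol-total (cutShape-arith d dX R k2 _ _ _ vol-total (cutShape-of ne)))))
        where open OfSet S
      open PrefixCut j nj jL
      open OfSet (prefixSet j) using () renaming (vol-total to vol-total-prefix; vol-positive to vol-positive-prefix; volᶜ-positive to volᶜ-positive-prefix)
      w = vol n k (complement n k (prefixSet j))
      wit : ∃ λ S → NonemptyProper n k S × Ncut n k S ≡ frac a Bd
      wit = prefixSet j , ne , ncut≡frac⁺ a Bd (cutC n k (prefixSet j)) (vol n k (prefixSet j)) w (vol-positive-prefix ne) (volᶜ-positive-prefix ne) B1
        (trans (cong (a *_) (trans (cong (_* w) vol-prefixSet) (prefix-product d e j nj jL hMe ej)))
          (trans (trans hyW (cong (λ z → 2 * z * Bd) (sym vol-total-prefix)))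
            (cong (λ z → z * (vol n k (prefixSet j) + w) * Bd) (sym cut-prefix))))

    mcut-viaTail : ∀ d e a Bd → 1 ≤ Bd → M ≡ e + d → 2 * (X * X) ≤ M * M + d * d → 2 * (d * d) ≤ X * X → d + 3 ≤ X → FarFrom d → (L ≡ suc n → d ≡ 0) →
      a ≡ M + M → Bd ≡ Qtail u X → IsMcut n k (frac a Bd)
    mcut-viaTail d e .(M + M) .(Qtail u X) B1 hMe H1 H2 dX R k2 refl refl = wit , low
      where
      low : (S : VSet n k) → NonemptyProper n k S → frac (M + M) (Qtail u X) ℚ.≤ Ncut n k S
      low S ne = frac≤ncut⁺ (M + M) (Qtail u X) (cutC n k S) (vol n k S) (vol n k (complement n k S)) (vol-positive ne) (volᶜ-positive ne) B1
        (subst (λ z → (M + M) * (vol n k S * vol n k (complement n k S)) ≤ cutC n k S * z * Qtail u X) (sym vol-total)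
          (≤-trans (*-monoʳ-≤ (M + M) (cutBound-Qtail M X u d e hM hMe H1 H2 _ _ _ vol-total (cutShape-arith d dX R k2 _ _ _ vol-total (cutShape-of ne))))
            (≤-reflexive (l (M + M) (cutC n k S) (Qtail u X)))))
        where
        open OfSet S
        l : ∀ a b c → a * (b * c) ≡ b * a * c
        l = solve-∀
      open TailCut
      open OfSet tailSet using () renaming (vol-total to vol-total-tail; vol-positive to vol-positive-tail; volᶜ-positive to volᶜ-positive-tail)
      w = vol n k (complement n k tailSet)
      uw : u + w ≡ M + M
      uw = trans (cong (_+ w) (sym vol-tailSet)) vol-total-tail
      weq : w ≡ X + X + u
      weq = +-cancelˡ-≡ u _ _ (trans uw (trans (cong (λ z → z + z) hM) (l X u)))
        where
        l : ∀ X u → X + u + (X + u) ≡ u + (X + X + u)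
        l = solve-∀
      wit : ∃ λ S → NonemptyProper n k S × Ncut n k S ≡ frac (M + M) (Qtail u X)
      wit = tailSet , ne , ncut≡frac⁺ (M + M) (Qtail u X) (cutC n k tailSet) (vol n k tailSet) w (vol-positive-tail ne) (volᶜ-positive-tail ne) B1
        (trans (cong (λ z → (M + M) * (z * w)) vol-tailSet)
          (trans (l (M + M) (u * w)) (trans (cong (λ a → a * (M + M) * (u * w)) (sym cut-tail))
            (trans (cong (λ b → cutC n k tailSet * b * (u * w)) (sym vol-total-tail)) (cong (λ b → cutC n k tailSet * (vol n k tailSet + w) * (u * b)) weq)))))
        where
        l : ∀ a b → a * b ≡ 1 * a * b
        l = solve-∀


module CaseArithmetic where

  open import Defs
  open ProductBounds
  open LadderVolumes
  open LadderSubsets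
  open MinimalityCriteria
  open import Data.Nat
  open import Data.Nat.Properties
  open import Data.Product using (_×_; _,_; Σ)
  open import Data.Sum using (_⊎_; inj₁; inj₂)
  open import Data.Empty
  open import Relation.Nullary
  open import Relation.Binary.PropositionalEquality
  open import Data.Nat.Tactic.RingSolver
  open import Data.Nat.Divisibility using (_∣_; divides; ∣m∣n⇒∣m+n; ∣m+n∣m⇒∣n; ∣m⇒∣m*n; ∣n⇒∣m*n; m∣m*n; ∣⇒≤)

  div2 : ∀ k → Σ ℕ λ b → (k ≡ 2 * b) ⊎ (k ≡ 2 * b + 1)
  div2 zero = 0 , inj₁ refl
  div2 (suc zero) = 0 , inj₂ refl
  div2 (suc (suc k)) with div2 k
  ... | b , inj₁ e = suc b , inj₁ (trans (cong (λ z → suc (suc z)) e) (l b))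
    where
    l : ∀ b → suc (suc (2 * b)) ≡ 2 * suc b
    l = solve-∀
  ... | b , inj₂ e = suc b , inj₂ (trans (cong (λ z → suc (suc z)) e) (l b))
    where
    l : ∀ b → suc (suc (2 * b + 1)) ≡ 2 * suc b + 1
    l = solve-∀

  div3 : ∀ n → Σ ℕ λ a → (n ≡ 3 * a) ⊎ (n ≡ 3 * a + 1) ⊎ (n ≡ 3 * a + 2)
  div3 zero = 0 , inj₁ refl
  div3 (suc zero) = 0 , inj₂ (inj₁ refl)
  div3 (suc (suc zero)) = 0 , inj₂ (inj₂ refl)
  div3 (suc (suc (suc n))) with div3 n
  ... | a , inj₁ e = suc a , inj₁ (trans (cong (λ z → 3 + z) e) (l a))
    where
    l : ∀ a → 3 + 3 * a ≡ 3 * suc a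
    l = solve-∀
  ... | a , inj₂ (inj₁ e) = suc a , inj₂ (inj₁ (trans (cong (λ z → 3 + z) e) (l a)))
    where
    l : ∀ a → 3 + (3 * a + 1) ≡ 3 * suc a + 1
    l = solve-∀
  ... | a , inj₂ (inj₂ e) = suc a , inj₂ (inj₂ (trans (cong (λ z → 3 + z) e) (l a)))
    where
    l : ∀ a → 3 + (3 * a + 2) ≡ 3 * suc a + 2
    l = solve-∀

  odd⇒2b+1 : ∀ k → ¬ 2 ∣ k → Σ ℕ λ b → k ≡ 2 * b + 1
  odd⇒2b+1 k h with div2 k
  ... | b , inj₁ e = ⊥-elim (h (divides b (trans e (*-comm 2 b))))
  ... | b , inj₂ e = b , e

  ¬3∣⇒residue : ∀ n → ¬ 3 ∣ n → Σ ℕ λ a → (n ≡ 3 * a + 1) ⊎ (n ≡ 3 * a + 2)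
  ¬3∣⇒residue n h with div3 n
  ... | a , inj₁ e = ⊥-elim (h (divides a (trans e (*-comm 3 a))))
  ... | a , inj₂ x = a , x

  module Cases (n k' : ℕ) (n1 : 1 ≤ n) where
    open Subsets n k' n1
    open Criteria n k' n1

    T : ℕ
    T = 12 * k

    s≡M+2 : 3 * k + 2 * n ≡ M + 2
    s≡M+2 = +-cancelˡ-≡ (2 * n) _ _ (trans (l1 n k) (trans Z2 (l2 M n)))
      where
      l1 : ∀ n k → 2 * n + (3 * k + 2 * n) ≡ 4 * n + 3 * k
      l1 = solve-∀
      l2 : ∀ M n → M + (2 * n + 2) ≡ 2 * n + (M + 2)
      l2 = solve-∀

    mK≡M : mK n k ≡ M
    mK≡M = trans (cong (_∸ 2) (trans (+-comm (2 * n) (3 * k)) s≡M+2)) (m+n∸n≡m M 2)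

    18k²≡2X² : 18 * (k * k) + 2 ≡ 2 * (X * X) + T
    18k²≡2X² = l k'
      where
      l : ∀ k' → 18 * (suc (suc k') * suc (suc k')) + 2 ≡ 2 * ((3 * k' + 5) * (3 * k' + 5)) + 12 * suc (suc k')
      l = solve-∀

    -- Since 18k² + 2 = 2X² + 12k, the thresholds compare M² + d² with 2X²
    -- (d = 0, 1, 2, 3 for K1, K2, K3, K4).
    ltK-rescale : ∀ a c → a + T ≤ 18 * (k * k) + c → a + 2 ≤ 2 * (X * X) + c
    ltK-rescale a c h = +-cancelʳ-≤ T (a + 2) (2 * (X * X) + c)
      (subst₂ _≤_ (l1 a T) (trans (l2 (18 * (k * k)) c) (trans (cong (_+ c) 18k²≡2X²) (l3 (2 * (X * X)) T c))) (+-monoˡ-≤ 2 h))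
      where
      l1 : ∀ a t → a + t + 2 ≡ a + 2 + t
      l1 = solve-∀
      l2 : ∀ a c → a + c + 2 ≡ a + 2 + c
      l2 = solve-∀
      l3 : ∀ a t c → a + t + c ≡ a + c + t
      l3 = solve-∀

    geK-rescale : ∀ a c → 18 * (k * k) + c ≤ a + T → 2 * (X * X) + c ≤ a + 2
    geK-rescale a c h = +-cancelʳ-≤ T (2 * (X * X) + c) (a + 2)
      (subst₂ _≤_ (trans (l2 (18 * (k * k)) c) (trans (cong (_+ c) 18k²≡2X²) (l3 (2 * (X * X)) T c))) (l1 a T) (+-monoˡ-≤ 2 h))
      where
      l1 : ∀ a t → a + t + 2 ≡ a + 2 + t
      l1 = solve-∀
      l2 : ∀ a c → a + c + 2 ≡ a + 2 + c
      l2 = solve-∀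
      l3 : ∀ a t c → a + t + c ≡ a + c + t
      l3 = solve-∀

    MM XX2 : ℕ
    MM = M * M
    XX2 = 2 * (X * X)

    mk : ∀ (P : ℕ → Set) → P (mK n k) → P M
    mk P h = subst P mK≡M h

    ltK1 : LtK1 n k → MM + 0 * 0 ≤ XX2
    ltK1 h = ≤-trans (≤-reflexive (+-identityʳ MM)) (<⇒≤ (+-cancelʳ-≤ 2 (suc MM) XX2
              (ltK-rescale (suc MM) 2 (mk (λ z → suc (z * z + T) ≤ 18 * (k * k) + 2) h))))

    ltK2 : LtK2 n k → MM + 1 * 1 ≤ XX2
    ltK2 h = ≤-trans (+-monoʳ-≤ MM (s≤s z≤n)) (+-cancelʳ-≤ 1 (MM + 2) XX2
              (subst (_≤ XX2 + 1) (l MM) (ltK-rescale (suc MM) 1 (mk (λ z → suc (z * z + T) ≤ 18 * (k * k) + 1) h))))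
      where
      l : ∀ a → suc a + 2 ≡ a + 2 + 1
      l = solve-∀

    ltK3 : LtK3 n k → MM + 2 * 2 ≤ XX2
    ltK3 h = ≤-trans (+-monoʳ-≤ MM (s≤s (s≤s (s≤s (s≤s z≤n))))) (subst (_≤ XX2) (l1 MM) (subst (MM + 3 + 2 ≤_) (+-identityʳ XX2)
              (ltK-rescale (MM + 3) 0 (subst₂ _≤_ (l MM T) (sym (+-identityʳ _)) (mk (λ z → suc (z * z + T + 2) ≤ 18 * (k * k)) h)))))
      where
      l : ∀ a t → suc (a + t + 2) ≡ a + 3 + t
      l = solve-∀
      l1 : ∀ a → a + 3 + 2 ≡ a + 5
      l1 = solve-∀

    ltK4 : LtK4 n k → MM + 3 * 3 ≤ XX2
    ltK4 h = ≤-trans (+-monoʳ-≤ MM (n≤1+n 9)) (subst (_≤ XX2) (l1 MM) (subst (MM + 8 + 2 ≤_) (+-identityʳ XX2)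
              (ltK-rescale (MM + 8) 0 (subst₂ _≤_ (l MM T) (sym (+-identityʳ _)) (mk (λ z → suc (z * z + T + 7) ≤ 18 * (k * k)) h)))))
      where
      l : ∀ a t → suc (a + t + 7) ≡ a + 8 + t
      l = solve-∀
      l1 : ∀ a → a + 8 + 2 ≡ a + 10
      l1 = solve-∀

    geK1 : GeK1 n k → XX2 ≤ MM + 0 * 0
    geK1 h = ≤-trans (+-cancelʳ-≤ 2 XX2 MM (geK-rescale MM 2 (mk (λ z → 18 * (k * k) + 2 ≤ z * z + T) h))) (≤-reflexive (sym (+-identityʳ MM)))

    geK2 : GeK2 n k → XX2 ≤ MM + 1 * 1
    geK2 h = +-cancelʳ-≤ 1 XX2 (MM + 1) (subst (XX2 + 1 ≤_) (l MM) (geK-rescale MM 1 (mk (λ z → 18 * (k * k) + 1 ≤ z * z + T) h)))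
      where
      l : ∀ a → a + 2 ≡ a + 1 + 1
      l = solve-∀

    geK3 : GeK3 n k → XX2 ≤ MM + 2 * 2
    geK3 h = subst₂ _≤_ (+-identityʳ XX2) (l1 MM) (geK-rescale (MM + 2) 0 (subst₂ _≤_ (sym (+-identityʳ _)) (l MM T) (mk (λ z → 18 * (k * k) ≤ z * z + T + 2) h)))
      where
      l : ∀ a t → a + t + 2 ≡ a + 2 + t
      l = solve-∀
      l1 : ∀ a → a + 2 + 2 ≡ a + 4
      l1 = solve-∀

    geK4 : GeK4 n k → XX2 ≤ MM + 3 * 3
    geK4 h = subst₂ _≤_ (+-identityʳ XX2) (l1 MM) (geK-rescale (MM + 7) 0 (subst₂ _≤_ (sym (+-identityʳ _)) (l MM T) (mk (λ z → 18 * (k * k) ≤ z * z + T + 7) h)))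
      where
      l : ∀ a t → a + t + 7 ≡ a + 7 + t
      l = solve-∀
      l1 : ∀ a → a + 7 + 2 ≡ a + 9
      l1 = solve-∀

    8≤X : 1 ≤ k' → 8 ≤ X
    8≤X k1 = +-monoˡ-≤ 5 (*-monoʳ-≤ 3 k1)

    5≤X : 5 ≤ X
    5≤X = m≤n+m 5 (3 * k')

    X≤M : X ≤ M
    X≤M = subst (X ≤_) (sym hM) (m≤m+n X u)

    3d²≤M² : ∀ d → d ≤ 3 → 1 ≤ k' → 3 * (d * d) ≤ M * M
    3d²≤M² d d3 k1 = ≤-trans (*-monoʳ-≤ 3 (*-mono-≤ d3 d3)) (≤-trans 27≤64 (*-mono-≤ M8 M8))
      where
      M8 : 8 ≤ M
      M8 = ≤-trans (8≤X k1) X≤M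
      27≤64 : 27 ≤ 64
      27≤64 = m≤m+n 27 37

    k≢2 : 1 ≤ k' → L ≡ suc n → ⊥
    k≢2 k1 e with +-cancelˡ-≡ n (suc k') 1 (trans e (sym (+-comm n 1)))
    ... | eq = <-irrefl (sym (suc-injective eq)) k1

    -- FarFrom d follows once no 6j lies at distance e < d from Z; this is excluded by
    -- divisibility: 6j ≡ 0 mod 6 while Z = 4n + 3k has prescribed residues mod 2 and 3.
    far-or-near : ∀ d x → (∀ e → e < d → (x + e ≡ Z ⊎ x ≡ Z + e) → ⊥) → x + d ≤ Z ⊎ Z + d ≤ x
    far-or-near d x h with x ≤? Z
    ... | yes p = g (difference p)
      where
      g : (Σ ℕ λ e → x + e ≡ Z) → x + d ≤ Z ⊎ Z + d ≤ x
      g (e , eq) with e <? d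
      ... | yes lt = ⊥-elim (h e lt (inj₁ eq))
      ... | no nlt = inj₁ (subst (x + d ≤_) eq (+-monoʳ-≤ x (≮⇒≥ nlt)))
    ... | no p = g (difference (<⇒≤ (≰⇒> p)))
      where
      g : (Σ ℕ λ e → Z + e ≡ x) → x + d ≤ Z ⊎ Z + d ≤ x
      g (e , eq) with e <? d
      ... | yes lt = ⊥-elim (h e lt (inj₂ (sym eq)))
      ... | no nlt = inj₂ (subst (Z + d ≤_) eq (+-monoʳ-≤ Z (≮⇒≥ nlt)))

    farFrom-residues : ∀ d → (∀ j e → e < d → (6 * j + e ≡ Z ⊎ 6 * j ≡ Z + e) → ⊥) → FarFrom d
    farFrom-residues d h j = far-or-near d (6 * j) (h j)

    3∣6j : ∀ j → 3 ∣ 6 * j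
    3∣6j j = ∣m⇒∣m*n j (divides 2 refl)

    2∣6j : ∀ j → 2 ∣ 6 * j
    2∣6j j = ∣m⇒∣m*n j (divides 3 refl)

    3∣Z : 3 ∣ n → 3 ∣ Z
    3∣Z h = ∣m∣n⇒∣m+n (∣n⇒∣m*n 4 h) (m∣m*n k)

    2∣Z : 2 ∣ k → 2 ∣ Z
    2∣Z h = ∣m∣n⇒∣m+n (∣m⇒∣m*n n (divides 2 refl)) (∣n⇒∣m*n 3 h)

    Z3 : Z ≡ (3 * n + 3 * k) + n
    Z3 = l n k
      where
      l : ∀ n k → 4 * n + 3 * k ≡ 3 * n + 3 * k + n
      l = solve-∀

    Z2' : Z ≡ (4 * n + 2 * k) + k
    Z2' = l n k
      where
      l : ∀ n k → 4 * n + 3 * k ≡ 4 * n + 2 * k + k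
      l = solve-∀

    D3a : ∀ x e → 3 ∣ x → (x + e ≡ Z ⊎ x ≡ Z + e) → 3 ∣ n → 3 ∣ e
    D3a x e hx (inj₁ eq) h = ∣m+n∣m⇒∣n (subst (3 ∣_) (sym eq) (3∣Z h)) hx
    D3a x e hx (inj₂ eq) h = ∣m+n∣m⇒∣n (subst (3 ∣_) eq hx) (3∣Z h)

    D3b : ∀ x e → 3 ∣ x → (x + e ≡ Z ⊎ x ≡ Z + e) → 3 ∣ e → 3 ∣ n
    D3b x e hx (inj₁ eq) he = ∣m+n∣m⇒∣n (subst (3 ∣_) (trans eq Z3) (∣m∣n⇒∣m+n hx he)) (∣m∣n⇒∣m+n (m∣m*n n) (m∣m*n k))
    D3b x e hx (inj₂ eq) he = ∣m+n∣m⇒∣n (subst (3 ∣_) (trans eq (trans (cong (_+ e) Z3) (l (3 * n + 3 * k) n e))) hx)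
                                (∣m∣n⇒∣m+n (∣m∣n⇒∣m+n (m∣m*n n) (m∣m*n k)) he)
      where
      l : ∀ a n e → a + n + e ≡ a + e + n
      l = solve-∀

    D2a : ∀ x e → 2 ∣ x → (x + e ≡ Z ⊎ x ≡ Z + e) → 2 ∣ k → 2 ∣ e
    D2a x e hx (inj₁ eq) h = ∣m+n∣m⇒∣n (subst (2 ∣_) (sym eq) (2∣Z h)) hx
    D2a x e hx (inj₂ eq) h = ∣m+n∣m⇒∣n (subst (2 ∣_) eq hx) (2∣Z h)

    D2b : ∀ x e → 2 ∣ x → (x + e ≡ Z ⊎ x ≡ Z + e) → 2 ∣ e → 2 ∣ k
    D2b x e hx (inj₁ eq) he = ∣m+n∣m⇒∣n (subst (2 ∣_) (trans eq Z2') (∣m∣n⇒∣m+n hx he)) (∣m∣n⇒∣m+n (∣m⇒∣m*n n (divides 2 refl)) (m∣m*n k))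
    D2b x e hx (inj₂ eq) he = ∣m+n∣m⇒∣n (subst (2 ∣_) (trans eq (trans (cong (_+ e) Z2') (l (4 * n + 2 * k) k e))) hx)
                                (∣m∣n⇒∣m+n (∣m∣n⇒∣m+n (∣m⇒∣m*n n (divides 2 refl)) (m∣m*n k)) he)
      where
      l : ∀ a n e → a + n + e ≡ a + e + n
      l = solve-∀

    not31 : ¬ 3 ∣ 1
    not31 h with ∣⇒≤ h
    ... | s≤s ()
    not32 : ¬ 3 ∣ 2
    not32 h with ∣⇒≤ h
    ... | s≤s (s≤s ())
    not21 : ¬ 2 ∣ 1
    not21 h with ∣⇒≤ h
    ... | s≤s ()

    -- The deficits: 0 if 3 ∣ n, 2 ∣ k; 3 if 3 ∣ n, 2 ∤ k; 2 if 3 ∤ n, 2 ∣ k; 1 otherwise.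
    far0 : FarFrom 0
    far0 = farFrom-residues 0 (λ j e lt _ → ⊥-elim (<-irrefl refl (≤-trans lt z≤n)))

    far3 : 3 ∣ n → ¬ 2 ∣ k → FarFrom 3
    far3 h3 h2 = farFrom-residues 3 f
      where
      f : ∀ j e → e < 3 → (6 * j + e ≡ Z ⊎ 6 * j ≡ Z + e) → ⊥
      f j 0 _ eq = h2 (D2b (6 * j) 0 (2∣6j j) eq (divides 0 refl))
      f j 1 _ eq = not31 (D3a (6 * j) 1 (3∣6j j) eq h3)
      f j 2 _ eq = h2 (D2b (6 * j) 2 (2∣6j j) eq (divides 1 refl))
      f j (suc (suc (suc e))) (s≤s (s≤s (s≤s ()))) eq

    far2 : ¬ 3 ∣ n → 2 ∣ k → FarFrom 2
    far2 h3 h2 = farFrom-residues 2 f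
      where
      f : ∀ j e → e < 2 → (6 * j + e ≡ Z ⊎ 6 * j ≡ Z + e) → ⊥
      f j 0 _ eq = h3 (D3b (6 * j) 0 (3∣6j j) eq (divides 0 refl))
      f j 1 _ eq = not21 (D2a (6 * j) 1 (2∣6j j) eq h2)
      f j (suc (suc e)) (s≤s (s≤s ())) eq

    far1 : ¬ 3 ∣ n → FarFrom 1
    far1 h3 = farFrom-residues 1 f
      where
      f : ∀ j e → e < 1 → (6 * j + e ≡ Z ⊎ 6 * j ≡ Z + e) → ⊥
      f j 0 _ eq = h3 (D3b (6 * j) 0 (3∣6j j) eq (divides 0 refl))
      f j (suc e) (s≤s ()) eq

    PrefixHits : ℕ → Set
    PrefixHits d = Σ ℕ λ j → (6 * j + d ≡ Z ⊎ 6 * j ≡ Z + d)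

    hitB : 3 ∣ n → 2 ∣ k → PrefixHits 0
    hitB (divides a ea) (divides b eb) = 2 * a + b , inj₁ (trans (l a b) (cong₂ (λ x y → 4 * x + 3 * y) (sym ea) (sym eb)))
      where
      l : ∀ a b → 6 * (2 * a + b) + 0 ≡ 4 * (a * 3) + 3 * (b * 2)
      l = solve-∀

    hitC : 3 ∣ n → ¬ 2 ∣ k → PrefixHits 3
    hitC (divides a ea) h2 with odd⇒2b+1 k h2
    ... | b , eb = 2 * a + b + 1 , inj₂ (trans (l a b) (cong₂ (λ x y → 4 * x + 3 * y + 3) (sym ea) (sym eb)))
      where
      l : ∀ a b → 6 * (2 * a + b + 1) ≡ 4 * (a * 3) + 3 * (2 * b + 1) + 3
      l = solve-∀

    hitD : ¬ 3 ∣ n → 2 ∣ k → PrefixHits 2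
    hitD h3 (divides b eb) with ¬3∣⇒residue n h3
    ... | a , inj₁ ea = 2 * a + b + 1 , inj₂ (trans (l a b) (cong₂ (λ x y → 4 * x + 3 * y + 2) (sym ea) (sym eb)))
      where
      l : ∀ a b → 6 * (2 * a + b + 1) ≡ 4 * (3 * a + 1) + 3 * (b * 2) + 2
      l = solve-∀
    ... | a , inj₂ ea = 2 * a + b + 1 , inj₁ (trans (l a b) (cong₂ (λ x y → 4 * x + 3 * y) (sym ea) (sym eb)))
      where
      l : ∀ a b → 6 * (2 * a + b + 1) + 2 ≡ 4 * (3 * a + 2) + 3 * (b * 2)
      l = solve-∀

    hitE : ¬ 3 ∣ n → ¬ 2 ∣ k → PrefixHits 1
    hitE h3 h2 with ¬3∣⇒residue n h3 | odd⇒2b+1 k h2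
    ... | a , inj₁ ea | b , eb = 2 * a + b + 1 , inj₁ (trans (l a b) (cong₂ (λ x y → 4 * x + 3 * y) (sym ea) (sym eb)))
      where
      l : ∀ a b → 6 * (2 * a + b + 1) + 1 ≡ 4 * (3 * a + 1) + 3 * (2 * b + 1)
      l = solve-∀
    ... | a , inj₂ ea | b , eb = 2 * a + b + 2 , inj₂ (trans (l a b) (cong₂ (λ x y → 4 * x + 3 * y + 1) (sym ea) (sym eb)))
      where
      l : ∀ a b → 6 * (2 * a + b + 2) ≡ 4 * (3 * a + 2) + 3 * (2 * b + 1) + 1
      l = solve-∀

    prefixHit-inRange : ∀ d → d ≤ 3 → 1 ≤ k' → u + d ≤ X → (w : PrefixHits d) →
      Σ ℕ λ j → n ≤ j × j ≤ L × (6 * j + d ≡ Z ⊎ 6 * j ≡ Z + d)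
    prefixHit-inRange d d3 k1 udX (j , ej) = j , nj , jL' , ej
      where
      lowZ : 6 * n + d ≤ Z
      lowZ = ≤-trans (≤-reflexive (trans (l n d) (cong (λ z → 4 * n + z + d) (sym u2))))
               (≤-trans (≤-reflexive (l2 n u d)) (≤-trans (+-monoʳ-≤ (4 * n + 1) udX) (≤-reflexive (l3 n k'))))
        where
        l : ∀ n d → 6 * n + d ≡ 4 * n + (n + n) + d
        l = solve-∀
        l2 : ∀ n u d → 4 * n + (u + 1) + d ≡ 4 * n + 1 + (u + d)
        l2 = solve-∀
        l3 : ∀ n k' → 4 * n + 1 + (3 * k' + 5) ≡ 4 * n + 3 * suc (suc k')
        l3 = solve-∀
      hiZ' : (6 * j + d ≡ Z ⊎ 6 * j ≡ Z + d) → Z ≤ 6 * j + d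
      hiZ' (inj₁ e) = ≤-reflexive (sym e)
      hiZ' (inj₂ e) = ≤-trans (m≤m+n Z d) (≤-trans (≤-reflexive (sym e)) (m≤m+n (6 * j) d))
      nj : n ≤ j
      nj = *-cancelˡ-≤ 6 (+-cancelʳ-≤ d (6 * n) (6 * j) (≤-trans lowZ (hiZ' ej)))
      hi6' : (6 * j + d ≡ Z ⊎ 6 * j ≡ Z + d) → 6 * j ≤ Z + d
      hi6' (inj₁ e) = ≤-trans (m≤m+n (6 * j) d) (≤-trans (≤-reflexive e) (m≤m+n Z d))
      hi6' (inj₂ e) = ≤-reflexive e
      hi6 = hi6' ej
      dle : d ≤ 2 * n + 3 * k'
      dle = ≤-trans d3 (≤-trans (m≤n+m 3 2) (+-mono-≤ (*-monoʳ-≤ 2 n1) (*-monoʳ-≤ 3 k1)))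
      ZL : Z + d ≤ 6 * L
      ZL = ≤-trans (+-monoʳ-≤ Z dle) (≤-reflexive (l n k'))
        where
        l : ∀ n k' → 4 * n + 3 * suc (suc k') + (2 * n + 3 * k') ≡ 6 * (n + suc k')
        l = solve-∀
      jL' : j ≤ L
      jL' = *-cancelˡ-≤ 6 (≤-trans hi6 ZL)

    1≤M : 1 ≤ M
    1≤M = ≤-trans (s≤s z≤n) (≤-trans 5≤X X≤M)

    -- The value 4M / ((M - d)(M + d)) is 2·2M / Qd, scaled.
    scaleBound : ∀ Q P c → 2 * P ≤ c * Q → 4 * M * P ≤ c * (M + M) * Q
    scaleBound Q P c h = ≤-trans (≤-reflexive (l M P)) (≤-trans (*-monoʳ-≤ (M + M) h) (≤-reflexive (l2 M c Q)))
      where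
      l : ∀ M P → 4 * M * P ≡ (M + M) * (2 * P)
      l = solve-∀
      l2 : ∀ M c Q → (M + M) * (c * Q) ≡ c * (M + M) * Q
      l2 = solve-∀

    scaleEq : ∀ Q → 4 * M * Q ≡ 2 * (M + M) * Q
    scaleEq Q = l M Q
      where
      l : ∀ M Q → 4 * M * Q ≡ 2 * (M + M) * Q
      l = solve-∀

    6≤X : 1 ≤ k' → 6 ≤ X
    6≤X k1 = ≤-trans (m≤m+n 6 2) (8≤X k1)

    mcut-smallN : ∀ d → d ≤ 3 → 1 ≤ k' → M * M + d * d ≤ 2 * (X * X) → FarFrom d → PrefixHits d →
      IsMcut n k (frac (4 * M) ((M ∸ d) * (M + d)))
    mcut-smallN d d3 k1 H1 R w = mcut-viaPrefix d (M ∸ d) (4 * M) ((M ∸ d) * (M + d)) B1 hMe H1 (3d²≤M² d d3 k1) H3 X1 dX R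
        (λ e → ⊥-elim (k≢2 k1 e)) (scaleBound ((M ∸ d) * (M + d))) (scaleEq ((M ∸ d) * (M + d))) (prefixHit-inRange d d3 k1 udX w)
      where
      dM : d ≤ M
      dM = ≤-trans d3 (≤-trans (m≤m+n 3 5) (≤-trans (8≤X k1) X≤M))
      hMe : M ≡ (M ∸ d) + d
      hMe = sym (m∸n+n≡m dM)
      B1 : 1 ≤ (M ∸ d) * (M + d)
      B1 = *-mono-≤ (+-cancelʳ-≤ d 1 (M ∸ d) (subst (1 + d ≤_) hMe (≤-trans (s≤s d3) (≤-trans (m≤m+n 4 4) (≤-trans (8≤X k1) X≤M)))))
                    (≤-trans 1≤M (m≤m+n M d))
      H3 : 2 * d ≤ X
      H3 = ≤-trans (*-monoʳ-≤ 2 d3) (6≤X k1)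
      X1 : 1 ≤ X
      X1 = ≤-trans (s≤s z≤n) 5≤X
      dX : d + 3 ≤ X
      dX = ≤-trans (+-monoˡ-≤ 3 d3) (6≤X k1)
      udX : u + d ≤ X
      udX = u+d≤X M X u d hM H1 H3 X1

    mcut-smallN₀ : 1 ≤ k' → 3 ∣ n → 2 ∣ k → M * M + 0 * 0 ≤ 2 * (X * X) → IsMcut n k (frac 4 M)
    mcut-smallN₀ k1 h3 h2 H1 = mcut-viaPrefix 0 M 4 M 1≤M (sym (+-identityʳ M)) H1 (3d²≤M² 0 z≤n k1) z≤n X1 dX far0
        (λ e → ⊥-elim (k≢2 k1 e)) hyA hyW (prefixHit-inRange 0 z≤n k1 udX (hitB h3 h2))
      where
      X1 : 1 ≤ X
      X1 = ≤-trans (s≤s z≤n) 5≤X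
      dX : 0 + 3 ≤ X
      dX = ≤-trans (m≤m+n 3 2) 5≤X
      udX : u + 0 ≤ X
      udX = u+d≤X M X u 0 hM H1 z≤n X1
      hyA : ∀ P c → 2 * P ≤ c * (M * (M + 0)) → 4 * P ≤ c * (M + M) * M
      hyA P c h = ≤-trans (≤-reflexive (l P)) (≤-trans (*-monoʳ-≤ 2 h) (≤-reflexive (l2 M c)))
        where
        l : ∀ P → 4 * P ≡ 2 * (2 * P)
        l = solve-∀
        l2 : ∀ M c → 2 * (c * (M * (M + 0))) ≡ c * (M + M) * M
        l2 = solve-∀
      hyW : 4 * (M * (M + 0)) ≡ 2 * (M + M) * M
      hyW = l M
        where
        l : ∀ M → 4 * (M * (M + 0)) ≡ 2 * (M + M) * M
        l = solve-∀

    1≤Qtail : 1 ≤ Qtail u X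
    1≤Qtail = *-mono-≤ 1≤u (≤-trans 1≤u (m≤n+m u (X + X)))

    mcut-largeN : ∀ d → d + 3 ≤ X → 2 * (d * d) ≤ X * X → (L ≡ suc n → d ≡ 0) → FarFrom d → d ≤ M →
      2 * (X * X) ≤ M * M + d * d → IsMcut n k (frac (M + M) (Qtail u X))
    mcut-largeN d dX H2 k2 R dM H1 = mcut-viaTail d (M ∸ d) (M + M) (Qtail u X) 1≤Qtail (sym (m∸n+n≡m dM)) H1 H2 dX R k2 refl refl

    mcut-largeN-k≥4 : 1 ≤ k' → ∀ d → d ≤ 3 → FarFrom d → 2 * (X * X) ≤ M * M + d * d → IsMcut n k (frac (M + M) (Qtail u X))
    mcut-largeN-k≥4 k1 d d3 R H1 = mcut-largeN d (≤-trans (+-monoˡ-≤ 3 d3) (6≤X k1))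
      (≤-trans (*-monoʳ-≤ 2 (*-mono-≤ d3 d3)) (≤-trans (m≤m+n 18 46) (*-mono-≤ (8≤X k1) (8≤X k1))))
      (λ e → ⊥-elim (k≢2 k1 e)) R (≤-trans d3 (≤-trans (m≤m+n 3 5) (≤-trans (8≤X k1) X≤M))) H1

    2t≤u+1 : ∀ t → t ≤ n → t + t ≤ u + 1
    2t≤u+1 t tn = ≤-trans (+-mono-≤ tn tn) (≤-reflexive (sym u2))

    mcut-largeN-k≡2 : k' ≡ 0 → 2 ≤ n → IsMcut n k (frac (M + M) (Qtail u X))
    mcut-largeN-k≡2 k0 n2 = mcut-largeN 0 (≤-trans (m≤m+n 3 2) 5≤X) z≤n (λ _ → refl) far0 z≤n H1
      where
      X5' : X ≡ 5
      X5' = cong (λ z → 3 * z + 5) k0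
      M8 : 8 ≤ M
      M8 = subst (8 ≤_) (sym hM) (subst (λ z → 8 ≤ z + u) (sym X5') (+-monoʳ-≤ 5 (+-cancelʳ-≤ 1 3 u (2t≤u+1 2 n2))))
      H1 : 2 * (X * X) ≤ M * M + 0 * 0
      H1 = subst (_≤ M * M + 0 * 0) (cong (λ z → 2 * (z * z)) (sym X5'))
        (≤-trans (m≤m+n 50 14) (≤-trans (*-mono-≤ M8 M8) (m≤m+n (M * M) 0)))

    mcut-largeN-k≡3 : k' ≡ 1 → 3 ≤ n → IsMcut n k (frac (M + M) (Qtail u X))
    mcut-largeN-k≡3 k0 n3 = mcut-largeN 0 (≤-trans (m≤m+n 3 2) 5≤X) z≤n (λ e → ⊥-elim (k≢2 (≤-reflexive (sym k0)) e)) far0 z≤n H1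
      where
      X8' : X ≡ 8
      X8' = cong (λ z → 3 * z + 5) k0
      M13 : 13 ≤ M
      M13 = subst (13 ≤_) (sym hM) (subst (λ z → 13 ≤ z + u) (sym X8') (+-monoʳ-≤ 8 (+-cancelʳ-≤ 1 5 u (2t≤u+1 3 n3))))
      H1 : 2 * (X * X) ≤ M * M + 0 * 0
      H1 = subst (_≤ M * M + 0 * 0) (cong (λ z → 2 * (z * z)) (sym X8'))
        (≤-trans (m≤m+n 128 41) (≤-trans (*-mono-≤ M13 M13) (m≤m+n (M * M) 0)))


module ClosedForms where

  open import Defs
  open ProductBounds
  open LadderSubsets
  open MinimalityCriteria
  open CaseArithmetic
  open import Data.Nat
  open import Data.Nat.Properties
  open import Relation.Nullary
  open import Relation.Binary.PropositionalEquality
  open import Data.Nat.Tactic.RingSolver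
  open import Data.Nat.Divisibility using (_∣_)

  module InTermsOfS (n k' : ℕ) (n1 : 1 ≤ n) where
    open Subsets n k' n1
    open Criteria n k' n1
    open Cases n k' n1

    s : ℕ
    s = 3 * k + 2 * n

    s≡2+M : s ≡ 2 + M
    s≡2+M = trans s≡M+2 (+-comm M 2)

    valueB : 1 ≤ k' → 3 ∣ n → 2 ∣ k → LtK1 n k → IsMcut n k (frac 4 (s ∸ 2))
    valueB k1 h3 h2 lt = subst (λ z → IsMcut n k (frac 4 (z ∸ 2))) (sym s≡2+M) (mcut-smallN₀ k1 h3 h2 (ltK1 lt))

    valueSmallN : ∀ d → d ≤ 3 → 1 ≤ k' → M * M + d * d ≤ 2 * (X * X) → FarFrom d → PrefixHits d → ∀ B →
      B ≡ (M ∸ d) * (M + d) → IsMcut n k (frac (4 * (s ∸ 2)) B)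
    valueSmallN d d3 k1 H1 R w B eB = subst₂ (λ a b → IsMcut n k (frac a b)) (cong (λ z → 4 * (z ∸ 2)) (sym s≡2+M)) (sym eB) (mcut-smallN d d3 k1 H1 R w)

    valueC : 1 ≤ k' → 3 ∣ n → ¬ 2 ∣ k → LtK4 n k → IsMcut n k (frac (4 * (s ∸ 2)) ((s ∸ 5) * (s + 1)))
    valueC k1 h3 h2 lt = valueSmallN 3 ≤-refl k1 (ltK4 lt) (far3 h3 h2) (hitC h3 h2) _
      (cong₂ _*_ (cong (_∸ 5) s≡2+M) (trans (cong (_+ 1) s≡2+M) (l M)))
      where
      l : ∀ M → 2 + M + 1 ≡ M + 3
      l = solve-∀

    valueD : 1 ≤ k' → ¬ 3 ∣ n → 2 ∣ k → LtK3 n k → IsMcut n k (frac (4 * (s ∸ 2)) ((s ∸ 4) * s))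
    valueD k1 h3 h2 lt = valueSmallN 2 (n≤1+n 2) k1 (ltK3 lt) (far2 h3 h2) (hitD h3 h2) _
      (cong₂ _*_ (cong (_∸ 4) s≡2+M) (trans s≡2+M (+-comm 2 M)))

    valueE : 1 ≤ k' → ¬ 3 ∣ n → ¬ 2 ∣ k → M * M + 1 * 1 ≤ 2 * (X * X) → IsMcut n k (frac (4 * (s ∸ 2)) ((s ∸ 3) * (s ∸ 1)))
    valueE k1 h3 h2 H1 = valueSmallN 1 (s≤s z≤n) k1 H1 (far1 h3) (hitE h3 h2) _
      (cong₂ _*_ (cong (_∸ 3) s≡2+M) (trans (cong (_∸ 1) s≡2+M) (+-comm 1 M)))

    numeratorF : (6 * k + 4 * n) ∸ 4 ≡ M + M
    numeratorF = trans (cong (_∸ 4) (trans (l n k) (cong (λ z → 2 * z) s≡M+2))) (trans (cong (_∸ 4) (l2 M)) (m+n∸n≡m (M + M) 4))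
      where
      l : ∀ n k → 6 * k + 4 * n ≡ 2 * (3 * k + 2 * n)
      l = solve-∀
      l2 : ∀ M → 2 * (M + 2) ≡ M + M + 4
      l2 = solve-∀

    denominatorF : (2 * n ∸ 1) * ((6 * k + 2 * n) ∸ 3) ≡ Qtail u X
    denominatorF = cong₂ _*_ (trans (cong (_∸ 1) (trans (l n) (sym u2))) (m+n∸n≡m u 1))
                   (trans (cong (_∸ 3) (trans (l2 n k') (cong (λ z → 6 * k' + 12 + z) (sym u2)))) (trans (cong (_∸ 3) (l3 k' u)) (m+n∸n≡m (X + X + u) 3)))
      where
      l : ∀ n → 2 * n ≡ n + n
      l = solve-∀
      l2 : ∀ n k' → 6 * suc (suc k') + 2 * n ≡ 6 * k' + 12 + (n + n)
      l2 = solve-∀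
      l3 : ∀ k' u → 6 * k' + 12 + (u + 1) ≡ (3 * k' + 5) + (3 * k' + 5) + u + 3
      l3 = solve-∀

    valueF : IsMcut n k (frac (M + M) (Qtail u X)) → IsMcut n k (frac ((6 * k + 4 * n) ∸ 4) ((2 * n ∸ 1) * ((6 * k + 2 * n) ∸ 3)))
    valueF = subst₂ (λ a b → IsMcut n k (frac a b)) (sym numeratorF) (sym denominatorF)


module TheoremParts where

  open import Defs
  open CutClassification
  open ProductBounds
  open RationalNcut
  open LadderSubsets
  open MinimalityCriteria
  open CaseArithmetic
  open ClosedForms
  open import Function using (case_of_)
  open import Data.Nat
  open import Data.Nat.Properties
  open import Data.Bool using (Bool; true; false; not)
  open import Data.Fin using () renaming (zero to fzero)
  open import Data.Product using (_×_; _,_)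
  open import Data.Sum using (_⊎_; inj₁; inj₂)
  open import Data.Unit using (tt)
  open import Relation.Nullary
  open import Relation.Nullary.Decidable using (toWitness)
  open import Relation.Binary.PropositionalEquality
  open import Data.Nat.Divisibility using (_∣_; ∣m+n∣m⇒∣n; ∣⇒≤; divides)
  import Data.Rational as ℚ

  -- For (n, k) = (1, 2) (M = 6, u = 1, X = 5) every cut is worse than the x-rail, which has
  -- cut 2 and volume M: Ncut = 2·12/36 = 2/3.
  railX : VSet 1 2
  railX (r , i) = not r

  mcut-1-2 : IsMcut 1 2 (frac 2 3)
  mcut-1-2 = (railX , (((false , fzero) , refl) , ((true , fzero) , refl)) , refl) , low
    where
    open Subsets 1 0 (s≤s z≤n)
    low : (S : VSet 1 2) → NonemptyProper 1 2 S → frac 2 3 ℚ.≤ Ncut 1 2 S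
    low S ne = frac≤ncut⁺ 2 3 (cutC 1 2 S) (vol 1 2 S) (vol 1 2 (complement 1 2 S)) (vol-positive ne) (volᶜ-positive ne) (s≤s z≤n)
       (subst (λ z → 2 * (vol 1 2 S * vol 1 2 (complement 1 2 S)) ≤ cutC 1 2 S * z * 3) (sym vol-total) (go (cutShape-of ne)))
      where
      open OfSet S
      c = cutC 1 2 S
      v = vol 1 2 S
      w = vol 1 2 (complement 1 2 S)
      go : CutShape c v w → 2 * (v * w) ≤ c * (M + M) * 3
      go (inj₁ c3) = ≤-trans (*-monoʳ-≤ 2 (product≤square v w M vol-total)) (≤-trans (toWitness {a? = 2 * (M * M) ≤? 3 * (M + M) * 3} tt)
                       (*-monoˡ-≤ 3 (*-monoˡ-≤ (M + M) c3)))
      go (inj₂ (inj₁ (e , x))) = subst (λ z → 2 * (v * w) ≤ z * (M + M) * 3) (sym e) (≤-trans (*-monoʳ-≤ 2 (product≤Qtail-either M X u v w hM vol-total x)) (toWitness {a? = 2 * Qtail u X ≤? 1 * (M + M) * 3} tt))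
      go (inj₂ (inj₂ (e , x))) = subst (λ z → 2 * (v * w) ≤ z * (M + M) * 3) (sym e) (≤-trans (*-monoʳ-≤ 2 (product≤square v w M vol-total)) (toWitness {a? = 2 * (M * M) ≤? 2 * (M + M) * 3} tt))

  not2∣3 : ¬ 2 ∣ 3
  not2∣3 h with ∣m+n∣m⇒∣n {2} {2} {1} h (divides 1 refl)
  ... | h1 with ∣⇒≤ h1
  ... | s≤s ()

  4≤k⇒1≤k′ : ∀ {k'} → 4 ≤ suc (suc k') → 1 ≤ k'
  4≤k⇒1≤k′ (s≤s (s≤s p)) = ≤-trans (s≤s z≤n) p

  partA : ∀ n k' → 1 ≤ n → (n ≡ 1 × suc (suc k') ≡ 2) → IsMcut n (suc (suc k')) (frac 2 3)
  partA .1 .0 _ (refl , refl) = mcut-1-2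

  partB : ∀ n k' → (n1 : 1 ≤ n) → let k = suc (suc k') in
    (4 ≤ k × 3 ∣ n × 2 ∣ k × LtK1 n k) → IsMcut n k (frac 4 ((3 * k + 2 * n) ∸ 2))
  partB n k' n1 (k4 , h3 , h2 , lt) = InTermsOfS.valueB n k' n1 (4≤k⇒1≤k′ k4) h3 h2 lt

  partC : ∀ n k' → (n1 : 1 ≤ n) → let k = suc (suc k') in
    (4 ≤ k × 3 ∣ n × ¬ (2 ∣ k) × LtK4 n k) →
    IsMcut n k (frac (4 * ((3 * k + 2 * n) ∸ 2)) (((3 * k + 2 * n) ∸ 5) * (3 * k + 2 * n + 1)))
  partC n k' n1 (k4 , h3 , h2 , lt) = InTermsOfS.valueC n k' n1 (4≤k⇒1≤k′ k4) h3 h2 lt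

  partD : ∀ n k' → (n1 : 1 ≤ n) → let k = suc (suc k') in
    (4 ≤ k × ¬ (3 ∣ n) × 2 ∣ k × LtK3 n k) →
    IsMcut n k (frac (4 * ((3 * k + 2 * n) ∸ 2)) (((3 * k + 2 * n) ∸ 4) * (3 * k + 2 * n)))
  partD n k' n1 (k4 , h3 , h2 , lt) = InTermsOfS.valueD n k' n1 (4≤k⇒1≤k′ k4) h3 h2 lt

  partE : ∀ n k' → (n1 : 1 ≤ n) → let k = suc (suc k') in
    ((4 ≤ k × ¬ (3 ∣ n) × ¬ (2 ∣ k) × LtK2 n k) ⊎ (n ≡ 1 × k ≡ 3) ⊎ (n ≡ 2 × k ≡ 3)) →
    IsMcut n k (frac (4 * ((3 * k + 2 * n) ∸ 2)) (((3 * k + 2 * n) ∸ 3) * ((3 * k + 2 * n) ∸ 1)))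
  partE n k' n1 (inj₁ (k4 , h3 , h2 , lt)) = InTermsOfS.valueE n k' n1 (4≤k⇒1≤k′ k4) h3 h2 (Cases.ltK2 n k' n1 lt)
  partE .1 .1 n1 (inj₂ (inj₁ (refl , refl))) = InTermsOfS.valueE 1 1 n1 ≤-refl (Cases.not31 1 1 n1) not2∣3
    (toWitness {a? = Subsets.M 1 1 n1 * Subsets.M 1 1 n1 + 1 * 1 ≤? 2 * (Subsets.X 1 1 n1 * Subsets.X 1 1 n1)} tt)
  partE .2 .1 n1 (inj₂ (inj₂ (refl , refl))) = InTermsOfS.valueE 2 1 n1 ≤-refl (Cases.not32 2 1 n1) not2∣3
    (toWitness {a? = Subsets.M 2 1 n1 * Subsets.M 2 1 n1 + 1 * 1 ≤? 2 * (Subsets.X 2 1 n1 * Subsets.X 2 1 n1)} tt)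

  partF : ∀ n k' → (n1 : 1 ≤ n) → let k = suc (suc k') in
    (((4 ≤ k ×
       ((3 ∣ n × 2 ∣ k × GeK1 n k) ⊎ (3 ∣ n × ¬ (2 ∣ k) × GeK4 n k) ⊎
        (¬ (3 ∣ n) × 2 ∣ k × GeK3 n k) ⊎ (¬ (3 ∣ n) × ¬ (2 ∣ k) × GeK2 n k)))
     ⊎ (k ≡ 2 × 2 ≤ n) ⊎ (k ≡ 3 × 3 ≤ n)) →
    IsMcut n k (frac ((6 * k + 4 * n) ∸ 4) ((2 * n ∸ 1) * ((6 * k + 2 * n) ∸ 3))))
  partF n k' n1 (inj₁ (k4 , regime)) = InTermsOfS.valueF n k' n1 (case regime of λ where
      (inj₁ (_ , _ , g)) → mcut-largeN-k≥4 k1 0 z≤n far0 (geK1 g)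
      (inj₂ (inj₁ (h3 , h2 , g))) → mcut-largeN-k≥4 k1 3 ≤-refl (far3 h3 h2) (geK4 g)
      (inj₂ (inj₂ (inj₁ (h3 , h2 , g)))) → mcut-largeN-k≥4 k1 2 (n≤1+n 2) (far2 h3 h2) (geK3 g)
      (inj₂ (inj₂ (inj₂ (h3 , _ , g)))) → mcut-largeN-k≥4 k1 1 (s≤s z≤n) (far1 h3) (geK2 g))
    where
    open Cases n k' n1
    k1 : 1 ≤ k'
    k1 = 4≤k⇒1≤k′ k4
  partF n .0 n1 (inj₂ (inj₁ (refl , n2))) = InTermsOfS.valueF n 0 n1 (Cases.mcut-largeN-k≡2 n 0 n1 refl n2)
  partF n .1 n1 (inj₂ (inj₂ (refl , n3))) = InTermsOfS.valueF n 1 n1 (Cases.mcut-largeN-k≡3 n 1 n1 refl n3)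

theorem2 : (n k : ℕ) → 1 ≤ n → 2 ≤ k →
    ((n ≡ 1 × k ≡ 2) → IsMcut n k (frac 2 3)) ×
    ((4 ≤ k × 3 ∣ n × 2 ∣ k × LtK1 n k) →
      IsMcut n k (frac 4 ((3 * k + 2 * n) ∸ 2))) ×
    ((4 ≤ k × 3 ∣ n × ¬ (2 ∣ k) × LtK4 n k) →
      IsMcut n k (frac (4 * ((3 * k + 2 * n) ∸ 2)) (((3 * k + 2 * n) ∸ 5) * (3 * k + 2 * n + 1)))) ×
    ((4 ≤ k × ¬ (3 ∣ n) × 2 ∣ k × LtK3 n k) →
      IsMcut n k (frac (4 * ((3 * k + 2 * n) ∸ 2)) (((3 * k + 2 * n) ∸ 4) * (3 * k + 2 * n)))) ×
    (((4 ≤ k × ¬ (3 ∣ n) × ¬ (2 ∣ k) × LtK2 n k) ⊎ (n ≡ 1 × k ≡ 3) ⊎ (n ≡ 2 × k ≡ 3)) →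
      IsMcut n k (frac (4 * ((3 * k + 2 * n) ∸ 2)) (((3 * k + 2 * n) ∸ 3) * ((3 * k + 2 * n) ∸ 1)))) ×
    (((4 ≤ k ×
        ((3 ∣ n × 2 ∣ k × GeK1 n k) ⊎ (3 ∣ n × ¬ (2 ∣ k) × GeK4 n k) ⊎
         (¬ (3 ∣ n) × 2 ∣ k × GeK3 n k) ⊎ (¬ (3 ∣ n) × ¬ (2 ∣ k) × GeK2 n k)))
      ⊎ (k ≡ 2 × 2 ≤ n) ⊎ (k ≡ 3 × 3 ≤ n)) →
      IsMcut n k (frac ((6 * k + 4 * n) ∸ 4) ((2 * n ∸ 1) * ((6 * k + 2 * n) ∸ 3))))
theorem2 n (suc (suc k')) n1 (s≤s (s≤s z≤n)) =
  partA n k' n1 , partB n k' n1 , partC n k' n1 , partD n k' n1 , partE n k' n1 , partF n k' n1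
  where open TheoremParts
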